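{- Let $p$ be an odd prime and let $P\in\mathbb{F}_p[x]$ be a polynomial of degree $\frac{p-1}{2}$ with $\sum_{x\in\mathbb{F}_p}P(x)=p$ (values regarded as integers in $\{0,\dots,p-1\}$, sum in $\mathbb{Z}$). Let $k\ge 0$ be an integer such that $$\#\Big\{\gamma\in\mathbb{F}_p:\ \Big|\sum_{a\in\mathbb{F}_p:\,P(a)=0}\left(\frac{a-\gamma}{p}\right)\Big|\ge \frac{p}{7}\Big\}\le k.$$ If $c$ is an integer with $k<c\le \frac{p-1}{2}-\frac{p}{7}$, then the leading coefficient of $P$ is not equal to $c$ (as an element of $\mathbb{F}_p$).
   Context: Elements of $\mathbb{F}_p$ are identified with the integers $\{0,1,\dots,p-1\}$. $\left(\frac{\cdot}{p}\right)$ denotes the Legendre symbol (with value $0$ at $0$). -}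

module Defs where

open import Data.Nat using (ℕ; zero; suc; _+_; _*_; _∸_; _^_; _≤_; _<_; _≟_; _≤?_; NonZero)
open import Data.Nat.DivMod using (_%_; _/_)
open import Data.Integer as ℤ using (ℤ; +_; -[1+_]; ∣_∣)
open import Data.Fin using (Fin; toℕ; fromℕ)
open import Data.List using (List; map; upTo; allFin)
open import Data.Nat.ListAction using (sum)
open import Data.Bool.ListAction using (any)
open import Data.Bool using (Bool; true; false; if_then_else_)
open import Relation.Nullary using (does)

half : ℕ → ℕ
half p = (p ∸ 1) / 2

-- A polynomial over F_p of degree ≤ d: coefficients c_0..c_d in F_p = Fin p.
Coeffs : ℕ → ℕ → Set
Coeffs p d = Fin (suc d) → Fin p

lead : ∀ {p d} → Coeffs p d → Fin p
lead {d = d} P = P (fromℕ d)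

eval : ∀ {p d} .{{_ : NonZero p}} → Coeffs p d → ℕ → ℕ
eval {p} {d} P x = sum (map (λ i → toℕ (P i) * x ^ toℕ i) (allFin (suc d))) % p

valueSum : ∀ {p d} .{{_ : NonZero p}} → Coeffs p d → ℕ
valueSum {p} P = sum (map (eval P) (upTo p))

legendre : (p : ℕ) .{{_ : NonZero p}} → ℕ → ℤ
legendre p a with does ((a % p) ≟ 0)
... | true = + 0
... | false = if any (λ y → does (((y * y) % p) ≟ (a % p))) (upTo p)
                then + 1 else -[1+ 0 ]

subMod : (p : ℕ) .{{_ : NonZero p}} → ℕ → ℕ → ℕ
subMod p a γ = (a + (p ∸ γ % p)) % p

charSum : ∀ {p d} .{{_ : NonZero p}} → Coeffs p d → ℕ → ℤ
charSum {p} P γ =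
  Data.List.foldr ℤ._+_ (+ 0)
    (map (λ a → if does (eval P a ≟ 0) then legendre p (subMod p a γ) else + 0) (upTo p))

-- #{γ ∈ F_p : |S(γ)| ≥ p/7}, where |S| ≥ p/7 ⇔ p ≤ 7·|S|
bigCount : ∀ {p d} .{{_ : NonZero p}} → Coeffs p d → ℕ
bigCount {p} P =
  sum (map (λ γ → if does (p ≤? 7 * ∣ charSum P γ ∣) then 1 else 0) (upTo p))

{-# OPTIONS --safe #-}
-- Write p = 2d + 1, c for the leading coefficient of P, χ(a) = (a/p), S(γ) for the
-- character sum over the zeros of P, and T(γ) = Σₓ P(x) χ(x - γ).
-- By Euler's criterion χ(a) ≡ a^d (mod p), so T(γ) ≡ Σₓ P(x) (x - γ)^d, the sum over F_p
-- of a polynomial of degree p - 1 with leading coefficient c; since Σₓ x^j ≡ 0 for j < p - 1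
-- and ≡ -1 for j = p - 1, T(γ) ≡ -c. As |T(γ)| ≤ Σₓ P(x) = p, T(γ) is -c or p - c, and
-- Σ_γ T(γ) = 0 (because Σ_γ χ(x - γ) = 0) forces T(γ) = p - c for exactly c values of γ.
-- Summing 1 - χ(x - γ) ≤ (P(x) + [P(x) = 0]) (1 - χ(x - γ)) over x gives
-- T(γ) + S(γ) ≤ #{x : P(x) = 0} ≤ d, so for those γ we get |S(γ)| ≥ d + 1 - c ≥ p/7.
-- Hence at least c values of γ are counted, which is impossible when k < c.
module Submission where

open import Defs

module _ where

  open import Data.Nat.Base as ℕ using (ℕ; zero; suc; z≤n; s≤s; NonZero; _%_; _/_)
  import Data.Nat.Properties as ℕP
  open import Data.Nat.Properties using (anyUpTo?)
  import Data.Nat.Divisibility as ℕD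
  import Data.Nat.DivMod as ℕDM
  open import Data.Nat.Combinatorics using (_C_; nCk+nC[k+1]≡[n+1]C[k+1]; k>n⇒nCk≡0; nC1≡n; nCk≡nC[n∸k]; nCn≡1)
  open import Data.Nat.Primality using (Prime; euclidsLemma; ¬prime[1])
  open import Data.Nat.Induction using (<-rec)
  open import Data.Nat.ListAction using (sum)
  import Data.Nat.Tactic.RingSolver as ℕS
  open import Data.Integer.Base using (ℤ; +_; -[1+_]; 0ℤ; 1ℤ; -1ℤ; _+_; _-_; _*_; -_; _^_; _≤_; _<_; ∣_∣; +≤+; +<+; -<-; -≤+; nonNegative)
  import Data.Integer.Properties as ℤP
  open import Data.Integer.Divisibility.Signed using (_∣_; divides; ∣⇒∣ᵤ; ∣ᵤ⇒∣; ∣m∣n⇒∣m+n; ∣m⇒∣-m; ∣n⇒∣m*n; ∣m⇒∣m*n; _∣?_)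
  open import Data.Integer.Tactic.RingSolver using (solve-∀)
  open import Algebra.Properties.CommutativeSemigroup ℤP.+-commutativeSemigroup using () renaming (interchange to +-interchange)
  open import Algebra.Properties.CommutativeSemigroup ℤP.*-commutativeSemigroup using () renaming (interchange to *-interchange)
  open import Algebra.Properties.CommutativeSemigroup ℕP.*-commutativeSemigroup using (x∙yz≈y∙xz)
  open import Data.Fin.Base as Fin using (Fin; toℕ; fromℕ)
  open import Data.Fin.Properties using (toℕ<n)
  open import Data.Vec.Base as Vec using (Vec; []; _∷_; last)
  open import Data.List.Base as List using (map; applyUpTo; upTo; allFin)
  open import Data.List.Properties using (map-tabulate; tabulate-cong)
  open import Data.List.Relation.Unary.Any.Properties using (any⁺; any⁻)
  open import Data.List.Membership.Propositional using (find; lose)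
  open import Data.List.Membership.Propositional.Properties using (∈-upTo⁺; ∈-upTo⁻)
  open import Data.Bool.Base as Bool using (Bool; true; false; if_then_else_)
  open import Data.Bool.ListAction using (any)
  open import Data.Empty using (⊥-elim)
  open import Data.Sum.Base as Sum using (_⊎_; inj₁; inj₂)
  open import Data.Product.Base using (∃; _×_; _,_; proj₁; proj₂)
  open import Function.Base using (_∘_)
  open import Relation.Nullary using (Dec; does; yes; no; ¬_; ¬?; _×-dec_)
  open import Relation.Nullary.Decidable using (map′)
  open import Relation.Binary.Definitions using (Decidable)
  open import Relation.Binary.Bundles using (Setoid)
  open import Relation.Binary.Structures using (IsEquivalence)
  import Relation.Binary.Reasoning.Setoid as SetoidReasoning
  open import Relation.Binary.PropositionalEquality

  -- Sums over initial segments of ℕ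

  infixr 6.5 ∑<

  ∑< : ℕ → (ℕ → ℤ) → ℤ
  ∑< zero    f = 0ℤ
  ∑< (suc n) f = f 0 + ∑< n (f ∘ suc)

  syntax ∑< n (λ x → e) = ∑[ x < n ] e

  𝟙 : ∀ {a} {A : Set a} → Dec A → ℤ
  𝟙 d = if does d then 1ℤ else 0ℤ

  ∑-cong : ∀ n {f g : ℕ → ℤ} → (∀ x → x ℕ.< n → f x ≡ g x) → ∑< n f ≡ ∑< n g
  ∑-cong zero    eq = refl
  ∑-cong (suc n) eq = cong₂ _+_ (eq 0 (s≤s z≤n)) (∑-cong n λ x x<n → eq (suc x) (s≤s x<n))

  ∑-mono-≤ : ∀ n {f g : ℕ → ℤ} → (∀ x → x ℕ.< n → f x ≤ g x) → ∑< n f ≤ ∑< n g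
  ∑-mono-≤ zero    le = ℤP.≤-refl
  ∑-mono-≤ (suc n) le = ℤP.+-mono-≤ (le 0 (s≤s z≤n)) (∑-mono-≤ n λ x x<n → le (suc x) (s≤s x<n))

  ∑-zero : ∀ n → ∑[ x < n ] 0ℤ ≡ 0ℤ
  ∑-zero zero    = refl
  ∑-zero (suc n) = trans (ℤP.+-identityˡ _) (∑-zero n)

  ∑-const : ∀ n k → ∑[ x < n ] k ≡ + n * k
  ∑-const zero    k = sym (ℤP.*-zeroˡ k)
  ∑-const (suc n) k = begin
    k + ∑[ x < n ] k      ≡⟨ cong (_+_ k) (∑-const n k) ⟩
    k + + n * k           ≡⟨ cong (_+ + n * k) (ℤP.*-identityˡ k) ⟨
    1ℤ * k + + n * k      ≡⟨ ℤP.*-distribʳ-+ k 1ℤ (+ n) ⟨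
    + suc n * k           ∎
    where open ≡-Reasoning

  ∑-distrib-+ : ∀ n (f g : ℕ → ℤ) → ∑[ x < n ] (f x + g x) ≡ ∑< n f + ∑< n g
  ∑-distrib-+ zero    f g = refl
  ∑-distrib-+ (suc n) f g = begin
    (f 0 + g 0) + ∑[ x < n ] (f (suc x) + g (suc x))
      ≡⟨ cong (_+_ (f 0 + g 0)) (∑-distrib-+ n (f ∘ suc) (g ∘ suc)) ⟩
    (f 0 + g 0) + (∑< n (f ∘ suc) + ∑< n (g ∘ suc))
      ≡⟨ +-interchange (f 0) (g 0) _ _ ⟩
    ∑< (suc n) f + ∑< (suc n) g ∎
    where open ≡-Reasoning

  *-distribˡ-∑ : ∀ n k (f : ℕ → ℤ) → k * ∑< n f ≡ ∑[ x < n ] (k * f x)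
  *-distribˡ-∑ zero    k f = ℤP.*-zeroʳ k
  *-distribˡ-∑ (suc n) k f = begin
    k * (f 0 + ∑< n (f ∘ suc))        ≡⟨ ℤP.*-distribˡ-+ k (f 0) _ ⟩
    k * f 0 + k * ∑< n (f ∘ suc)      ≡⟨ cong (_+_ (k * f 0)) (*-distribˡ-∑ n k (f ∘ suc)) ⟩
    ∑[ x < suc n ] (k * f x)          ∎
    where open ≡-Reasoning

  ∑-neg : ∀ n (f : ℕ → ℤ) → ∑[ x < n ] (- f x) ≡ - ∑< n f
  ∑-neg n f = begin
    ∑[ x < n ] (- f x)          ≡⟨ ∑-cong n (λ x _ → ℤP.-1*i≡-i (f x)) ⟨
    ∑[ x < n ] (- 1ℤ * f x)     ≡⟨ *-distribˡ-∑ n (- 1ℤ) f ⟨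
    - 1ℤ * ∑< n f               ≡⟨ ℤP.-1*i≡-i _ ⟩
    - ∑< n f                    ∎
    where open ≡-Reasoning

  ∑-distrib-- : ∀ n (f g : ℕ → ℤ) → ∑[ x < n ] (f x - g x) ≡ ∑< n f - ∑< n g
  ∑-distrib-- n f g = trans (∑-distrib-+ n f (λ x → - g x)) (cong (_+_ (∑< n f)) (∑-neg n g))

  ∑-last : ∀ n (f : ℕ → ℤ) → ∑< (suc n) f ≡ ∑< n f + f n
  ∑-last zero    f = ℤP.+-comm (f 0) 0ℤ
  ∑-last (suc n) f = begin
    f 0 + ∑< (suc n) (f ∘ suc)        ≡⟨ cong (_+_ (f 0)) (∑-last n (f ∘ suc)) ⟩
    f 0 + (∑< n (f ∘ suc) + f (suc n)) ≡⟨ ℤP.+-assoc (f 0) _ _ ⟨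
    ∑< (suc n) f + f (suc n)           ∎
    where open ≡-Reasoning

  ∑-comm : ∀ m n (f : ℕ → ℕ → ℤ) → ∑[ x < m ] ∑[ y < n ] f x y ≡ ∑[ y < n ] ∑[ x < m ] f x y
  ∑-comm zero    n f = sym (∑-zero n)
  ∑-comm (suc m) n f = begin
    ∑[ y < n ] f 0 y + ∑[ x < m ] ∑[ y < n ] f (suc x) y
      ≡⟨ cong (_+_ (∑[ y < n ] f 0 y)) (∑-comm m n (f ∘ suc)) ⟩
    ∑[ y < n ] f 0 y + ∑[ y < n ] ∑[ x < m ] f (suc x) y
      ≡⟨ ∑-distrib-+ n (f 0) (λ y → ∑[ x < m ] f (suc x) y) ⟨
    ∑[ y < n ] ∑[ x < suc m ] f x y ∎
    where open ≡-Reasoning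

  ∑-telescope : ∀ n (f : ℕ → ℤ) → ∑[ x < n ] (f (suc x) - f x) ≡ f n - f 0
  ∑-telescope zero    f = sym (ℤP.+-inverseʳ (f 0))
  ∑-telescope (suc n) f = begin
    (f 1 - f 0) + ∑[ x < n ] (f (suc (suc x)) - f (suc x))
      ≡⟨ cong (_+_ (f 1 - f 0)) (∑-telescope n (f ∘ suc)) ⟩
    (f 1 - f 0) + (f (suc n) - f 1)
      ≡⟨ shuffle (f 0) (f 1) (f (suc n)) ⟩
    f (suc n) - f 0 ∎
    where
    open ≡-Reasoning
    shuffle : ∀ a b c → (b - a) + (c - b) ≡ c - a
    shuffle = solve-∀

  ∑-𝟙-≡ : ∀ n {a} → a ℕ.< n → ∑[ x < n ] 𝟙 (x ℕP.≟ a) ≡ 1ℤ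
  ∑-𝟙-≡ (suc n) {zero}  _         = cong (_+_ 1ℤ) (∑-zero n)
  ∑-𝟙-≡ (suc n) {suc a} (s≤s a<n) = trans (ℤP.+-identityˡ _) (∑-𝟙-≡ n a<n)

  𝟙-nonneg : ∀ {a} {A : Set a} (d : Dec A) → 0ℤ ≤ 𝟙 d
  𝟙-nonneg (yes _) = +≤+ z≤n
  𝟙-nonneg (no _)  = ℤP.≤-refl

  𝟙-no : ∀ {a} {A : Set a} (d : Dec A) → ¬ A → 𝟙 d ≡ 0ℤ
  𝟙-no (yes a) ¬a = ⊥-elim (¬a a)
  𝟙-no (no _)  _  = refl

  𝟙-mono : ∀ {a b} {A : Set a} {B : Set b} (A? : Dec A) (B? : Dec B) → (A → B) → 𝟙 A? ≤ 𝟙 B?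
  𝟙-mono (yes a) (yes _) _   = ℤP.≤-refl
  𝟙-mono (yes a) (no ¬b) a⇒b = ⊥-elim (¬b (a⇒b a))
  𝟙-mono (no _)  B?      _   = 𝟙-nonneg B?

  𝟙-cong : ∀ {a b} {A : Set a} {B : Set b} (A? : Dec A) (B? : Dec B) → (A → B) → (B → A) → 𝟙 A? ≡ 𝟙 B?
  𝟙-cong A? B? a⇒b b⇒a = ℤP.≤-antisym (𝟙-mono A? B? a⇒b) (𝟙-mono B? A? b⇒a)

  if-does≡𝟙* : ∀ {a} {A : Set a} (A? : Dec A) k → (if does A? then k else 0ℤ) ≡ 𝟙 A? * k
  if-does≡𝟙* (yes _) k = sym (ℤP.*-identityˡ k)
  if-does≡𝟙* (no _)  k = sym (ℤP.*-zeroˡ k)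

  +-if-does≡𝟙 : ∀ {a} {A : Set a} (A? : Dec A) → + (if does A? then 1 else 0) ≡ 𝟙 A?
  +-if-does≡𝟙 (yes _) = refl
  +-if-does≡𝟙 (no _)  = refl

  𝟙-≤-+ : ∀ {a b c} {A : Set a} {B : Set b} {C : Set c} (A? : Dec A) (B? : Dec B) (C? : Dec C) →
          (A → B ⊎ C) → 𝟙 A? ≤ 𝟙 B? + 𝟙 C?
  𝟙-≤-+ (no _)  B? C? _ = ℤP.+-mono-≤ (𝟙-nonneg B?) (𝟙-nonneg C?)
  𝟙-≤-+ (yes a) B? C? split with split a
  𝟙-≤-+ (yes a) (yes _) C? _ | inj₁ _ = ℤP.+-monoʳ-≤ 1ℤ (𝟙-nonneg C?)
  𝟙-≤-+ (yes a) (no ¬b) C? _ | inj₁ b = ⊥-elim (¬b b)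
  𝟙-≤-+ (yes a) B? (yes _) _ | inj₂ _ = ℤP.+-monoˡ-≤ 1ℤ (𝟙-nonneg B?)
  𝟙-≤-+ (yes a) B? (no ¬c) _ | inj₂ c = ⊥-elim (¬c c)

  𝟙-disjoint-≤ : ∀ {a b c} {A : Set a} {B : Set b} {C : Set c} (A? : Dec A) (B? : Dec B) (C? : Dec C) →
                 (A → C) → (B → C) → (A → ¬ B) → 𝟙 A? + 𝟙 B? ≤ 𝟙 C?
  𝟙-disjoint-≤ (yes a) (yes b) C?      _   _   a⇒¬b = ⊥-elim (a⇒¬b a b)
  𝟙-disjoint-≤ (yes a) (no _)  (yes _) _   _   _    = ℤP.≤-refl
  𝟙-disjoint-≤ (yes a) (no _)  (no ¬c) a⇒c _   _    = ⊥-elim (¬c (a⇒c a))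
  𝟙-disjoint-≤ (no _)  (yes b) (yes _) _   _   _    = ℤP.≤-refl
  𝟙-disjoint-≤ (no _)  (yes b) (no ¬c) _   b⇒c _    = ⊥-elim (¬c (b⇒c b))
  𝟙-disjoint-≤ (no _)  (no _)  C?      _   _   _    = 𝟙-nonneg C?

  count-≥-injection : ∀ n {q} {Q : ℕ → Set q} (Q? : ∀ x → Dec (Q x)) K (f : ℕ → ℕ) →
                      (∀ i → i ℕ.< K → f i ℕ.< n × Q (f i)) →
                      (∀ {i j} → i ℕ.< K → j ℕ.< K → f i ≡ f j → i ≡ j) →
                      + K ≤ ∑[ x < n ] 𝟙 (Q? x)
  count-≥-injection n Q? zero    f _    _   =
    ℤP.≤-trans (ℤP.≤-reflexive (sym (∑-zero n))) (∑-mono-≤ n λ x _ → 𝟙-nonneg (Q? x))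
  count-≥-injection n {Q = Q} Q? (suc K) f good inj = begin
    + suc K
      ≡⟨ cong +_ (ℕP.+-comm 1 K) ⟩
    + K + 1ℤ
      ≤⟨ ℤP.+-mono-≤ ih (ℤP.≤-reflexive (sym (∑-𝟙-≡ n a<n))) ⟩
    ∑[ x < n ] 𝟙 (Q′? x) + ∑[ x < n ] 𝟙 (x ℕP.≟ a)
      ≡⟨ ∑-distrib-+ n (λ x → 𝟙 (Q′? x)) (λ x → 𝟙 (x ℕP.≟ a)) ⟨
    ∑[ x < n ] (𝟙 (Q′? x) + 𝟙 (x ℕP.≟ a))
      ≤⟨ ∑-mono-≤ n (λ x _ → 𝟙-disjoint-≤ (Q′? x) (x ℕP.≟ a) (Q? x) proj₁ (λ where refl → Qa) proj₂) ⟩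
    ∑[ x < n ] 𝟙 (Q? x) ∎
    where
    open ℤP.≤-Reasoning
    a = f K
    a<n = proj₁ (good K (ℕP.n<1+n K))
    Qa  = proj₂ (good K (ℕP.n<1+n K))
    Q′ : ℕ → Set _
    Q′ x = Q x × x ≢ a
    Q′? : ∀ x → Dec (Q′ x)
    Q′? x = Q? x ×-dec ¬? (x ℕP.≟ a)
    ih : + K ≤ ∑[ x < n ] 𝟙 (Q′? x)
    ih = count-≥-injection n Q′? K f
           (λ i i<K → proj₁ (good i (ℕP.m<n⇒m<1+n i<K)) , proj₂ (good i (ℕP.m<n⇒m<1+n i<K)) ,
                      λ fi≡a → ℕP.<-irrefl (inj (ℕP.m<n⇒m<1+n i<K) (ℕP.n<1+n K) fi≡a) i<K)
           (λ i<K j<K → inj (ℕP.m<n⇒m<1+n i<K) (ℕP.m<n⇒m<1+n j<K))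

  ≤-1-𝟙 : ∀ {a} {A : Set a} {i} (A? : Dec A) → (A → i ≤ 0ℤ) → i ≤ 1ℤ → i ≤ 1ℤ - 𝟙 A?
  ≤-1-𝟙 (yes a) i≤0 _   = i≤0 a
  ≤-1-𝟙 (no _)  _   i≤1 = i≤1

  ∑-≤-with-zero-term : ∀ m {a} (f : ℕ → ℤ) → a ℕ.< suc m → f a ≡ 0ℤ →
                       (∀ x → x ℕ.< suc m → f x ≤ 1ℤ) → ∑< (suc m) f ≤ + m
  ∑-≤-with-zero-term m {a} f a<1+m fa≡0 f≤1 = begin
    ∑< (suc m) f
      ≤⟨ ∑-mono-≤ (suc m) (λ x x<1+m → f≤1-δ x (f≤1 x x<1+m)) ⟩
    ∑[ x < suc m ] (1ℤ - 𝟙 (x ℕP.≟ a))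
      ≡⟨ ∑-distrib-- (suc m) (λ _ → 1ℤ) (λ x → 𝟙 (x ℕP.≟ a)) ⟩
    ∑[ x < suc m ] 1ℤ - ∑[ x < suc m ] 𝟙 (x ℕP.≟ a)
      ≡⟨ cong₂ _-_ (trans (∑-const (suc m) 1ℤ) (ℤP.*-identityʳ (+ suc m))) (∑-𝟙-≡ (suc m) a<1+m) ⟩
    + suc m - 1ℤ
      ≡⟨⟩
    + m ∎
    where
    open ℤP.≤-Reasoning
    f≤1-δ : ∀ x → f x ≤ 1ℤ → f x ≤ 1ℤ - 𝟙 (x ℕP.≟ a)
    f≤1-δ x = ≤-1-𝟙 (x ℕP.≟ a) λ where refl → ℤP.≤-reflexive fa≡0

  ∑-signs-with-zero : ∀ n {a} (f : ℕ → ℤ) → a ℕ.< n → f a ≡ 0ℤ →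
                      (∀ x → x ℕ.< n → -1ℤ ≤ f x × f x ≤ 1ℤ) →
                      - + n < ∑< n f × ∑< n f < + n
  ∑-signs-with-zero (suc m) f a<n fa≡0 signs = lower , ℤP.≤-<-trans upper (+<+ (ℕP.n<1+n m))
    where
    upper : ∑< (suc m) f ≤ + m
    upper = ∑-≤-with-zero-term m f a<n fa≡0 (λ x x<n → proj₂ (signs x x<n))
    upper-neg : ∑[ x < suc m ] (- f x) ≤ + m
    upper-neg = ∑-≤-with-zero-term m (λ x → - f x) a<n (cong -_ fa≡0) (λ x x<n → ℤP.neg-mono-≤ (proj₁ (signs x x<n)))
    lower : - + suc m < ∑< (suc m) f
    lower = ℤP.<-≤-trans (ℤP.neg-mono-< (+<+ (ℕP.n<1+n m)))
              (subst (- + m ≤_) (ℤP.neg-involutive _) (ℤP.neg-mono-≤ (subst (_≤ + m) (∑-neg (suc m) f) upper-neg)))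

  -- Congruences modulo m

  module Congruence (m : ℕ) where

    infix 4 _≈_ _≉_ _≈?_

    record _≈_ (a b : ℤ) : Set where
      constructor mk≈
      field divides-difference : + m ∣ a - b

    _≉_ : ℤ → ℤ → Set
    a ≉ b = ¬ (a ≈ b)

    private
      mk≈′ : ∀ {d a b} → d ≡ a - b → + m ∣ d → a ≈ b
      mk≈′ refl m∣d = mk≈ m∣d

    ∣⇒≈0 : ∀ {a} → + m ∣ a → a ≈ 0ℤ
    ∣⇒≈0 {a} = mk≈′ (sym (ℤP.+-identityʳ a))

    ≈0⇒∣ : ∀ {a} → a ≈ 0ℤ → + m ∣ a
    ≈0⇒∣ {a} (mk≈ m∣a) = subst (+ m ∣_) (ℤP.+-identityʳ a) m∣a

    ≈-reflexive : ∀ {a b} → a ≡ b → a ≈ b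
    ≈-reflexive {a} refl = mk≈ (divides 0ℤ (ℤP.+-inverseʳ a))

    ≈-refl : ∀ {a} → a ≈ a
    ≈-refl = ≈-reflexive refl

    ≈-sym : ∀ {a b} → a ≈ b → b ≈ a
    ≈-sym {a} {b} (mk≈ m∣a-b) = mk≈′ (negate a b) (∣m⇒∣-m m∣a-b)
      where
      negate : ∀ a b → - (a - b) ≡ b - a
      negate = solve-∀

    ≈-trans : ∀ {a b c} → a ≈ b → b ≈ c → a ≈ c
    ≈-trans {a} {b} {c} (mk≈ m∣a-b) (mk≈ m∣b-c) = mk≈′ (chain a b c) (∣m∣n⇒∣m+n m∣a-b m∣b-c)
      where
      chain : ∀ a b c → (a - b) + (b - c) ≡ a - c
      chain = solve-∀

    ≈-isEquivalence : IsEquivalence _≈_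
    ≈-isEquivalence = record { refl = ≈-refl ; sym = ≈-sym ; trans = ≈-trans }

    ≈-setoid : Setoid _ _
    ≈-setoid = record { isEquivalence = ≈-isEquivalence }

    module ≈-Reasoning = SetoidReasoning ≈-setoid

    +-cong : ∀ {a b c d} → a ≈ b → c ≈ d → a + c ≈ b + d
    +-cong {a} {b} {c} {d} (mk≈ m∣a-b) (mk≈ m∣c-d) = mk≈′ (interchange a b c d) (∣m∣n⇒∣m+n m∣a-b m∣c-d)
      where
      interchange : ∀ a b c d → (a - b) + (c - d) ≡ (a + c) - (b + d)
      interchange = solve-∀

    neg-cong : ∀ {a b} → a ≈ b → - a ≈ - b
    neg-cong {a} {b} (mk≈ m∣a-b) = mk≈′ (negate a b) (∣m⇒∣-m m∣a-b)
      where
      negate : ∀ a b → - (a - b) ≡ (- a) - (- b)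
      negate = solve-∀

    -‿cong : ∀ {a b c d} → a ≈ b → c ≈ d → a - c ≈ b - d
    -‿cong a≈b c≈d = +-cong a≈b (neg-cong c≈d)

    *-cong : ∀ {a b c d} → a ≈ b → c ≈ d → a * c ≈ b * d
    *-cong {a} {b} {c} {d} (mk≈ m∣a-b) (mk≈ m∣c-d) =
      mk≈′ (expand a b c d) (∣m∣n⇒∣m+n (∣n⇒∣m*n a m∣c-d) (∣m⇒∣m*n d m∣a-b))
      where
      expand : ∀ a b c d → a * (c - d) + (a - b) * d ≡ a * c - b * d
      expand = solve-∀

    ^-cong : ∀ {a b} n → a ≈ b → a ^ n ≈ b ^ n
    ^-cong zero    a≈b = ≈-refl
    ^-cong (suc n) a≈b = *-cong a≈b (^-cong n a≈b)

    ∑-cong-≈ : ∀ n {f g : ℕ → ℤ} → (∀ x → x ℕ.< n → f x ≈ g x) → ∑< n f ≈ ∑< n g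
    ∑-cong-≈ zero    f≈g = ≈-refl
    ∑-cong-≈ (suc n) f≈g = +-cong (f≈g 0 (s≤s z≤n)) (∑-cong-≈ n λ x x<n → f≈g (suc x) (s≤s x<n))

    modulus≈0 : + m ≈ 0ℤ
    modulus≈0 = ∣⇒≈0 (divides 1ℤ (sym (ℤP.*-identityˡ (+ m))))

    %-≈ : ∀ a .{{_ : NonZero m}} → + (a % m) ≈ + a
    %-≈ a = ≈-sym (mk≈′ (division a) (divides (+ (a / m)) refl))
      where
      division : ∀ a → + (a / m) * + m ≡ + a - + (a % m)
      division a = begin
        + (a / m) * + m
          ≡⟨ cancel (+ (a % m)) (+ (a / m) * + m) ⟩
        (+ (a % m) + + (a / m) * + m) - + (a % m)
          ≡⟨ cong (_- + (a % m)) (sym (trans (cong +_ (ℕDM.m≡m%n+[m/n]*n a m)) ℕ→ℤ)) ⟩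
        + a - + (a % m) ∎
        where
        open ≡-Reasoning
        cancel : ∀ r s → s ≡ (r + s) - r
        cancel = solve-∀
        ℕ→ℤ : + (a % m ℕ.+ a / m ℕ.* m) ≡ + (a % m) + + (a / m) * + m
        ℕ→ℤ = trans (ℤP.pos-+ (a % m) _) (cong (_+_ (+ (a % m))) (ℤP.pos-* (a / m) m))

    -≈0⇒≈ : ∀ {a b} → a - b ≈ 0ℤ → a ≈ b
    -≈0⇒≈ a-b≈0 = mk≈ (≈0⇒∣ a-b≈0)

    %-≡⇒≈ : ∀ {a b} .{{_ : NonZero m}} → a % m ≡ b % m → + a ≈ + b
    %-≡⇒≈ {a} {b} a≡b = ≈-trans (≈-sym (%-≈ a)) (≈-trans (≈-reflexive (cong +_ a≡b)) (%-≈ b))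

    ≈0-small⇒≡0 : ∀ {a} → a ≈ 0ℤ → ∣ a ∣ ℕ.< m → a ≡ 0ℤ
    ≈0-small⇒≡0 {a} a≈0 ∣a∣<m with ∣ a ∣ ℕP.≟ 0
    ... | yes ∣a∣≡0 = ℤP.∣i∣≡0⇒i≡0 ∣a∣≡0
    ... | no  ∣a∣≢0 = ⊥-elim (ℕD.>⇒∤ ⦃ ℕ.≢-nonZero ∣a∣≢0 ⦄ ∣a∣<m (∣⇒∣ᵤ (≈0⇒∣ a≈0)))

    positive≉0 : ∀ {n} → 0 ℕ.< n → n ℕ.< m → + n ≉ 0ℤ
    positive≉0 0<n n<m n≈0 = ℕP.<⇒≢ 0<n (sym (ℤP.+-injective (≈0-small⇒≡0 n≈0 n<m)))

    ≈0-bounded⇒≡0 : ∀ {a} → a ≈ 0ℤ → - + m < a → a < + m → a ≡ 0ℤ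
    ≈0-bounded⇒≡0 {a} a≈0 -m<a a<m = ≈0-small⇒≡0 a≈0 (abs< a -m<a a<m)
      where
      abs< : ∀ {m} a → - + m < a → a < + m → ∣ a ∣ ℕ.< m
      abs< (+ k)           _         (+<+ k<m) = k<m
      abs< {suc m} -[1+ k ] (-<- k<m) _         = s≤s k<m

    ≈0-below-2m : ∀ {a} .{{_ : NonZero m}} → a ≈ 0ℤ → - + m < a → a < + m + + m → a ≡ 0ℤ ⊎ a ≡ + m
    ≈0-below-2m {a} a≈0 -m<a a<2m with a ℤP.<? + m
    ... | yes a<m = inj₁ (≈0-bounded⇒≡0 a≈0 -m<a a<m)
    ... | no  a≮m = inj₂ (ℤP.i-j≡0⇒i≡j a (+ m) (≈0-bounded⇒≡0 a-m≈0 -m<a-m a-m<m))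
      where
      a-m≈0 : a - + m ≈ 0ℤ
      a-m≈0 = -‿cong a≈0 modulus≈0
      -m<a-m : - + m < a - + m
      -m<a-m = ℤP.<-≤-trans (ℤP.neg-mono-< (+<+ (ℕ.>-nonZero⁻¹ m))) (ℤP.i≤j⇒0≤j-i (ℤP.≮⇒≥ a≮m))
      a-m<m : a - + m < + m
      a-m<m = subst (a - + m <_) (cancel (+ m)) (ℤP.+-monoˡ-< (- + m) a<2m)
        where
        cancel : ∀ m → m + m - m ≡ m
        cancel = solve-∀

    residue-injective : ∀ {x y} → x ℕ.< m → y ℕ.< m → + x ≈ + y → x ≡ y
    residue-injective {x} {y} x<m y<m (mk≈ m∣x-y) =
      ℤP.+-injective (ℤP.i-j≡0⇒i≡j (+ x) (+ y) (≈0-small⇒≡0 (∣⇒≈0 m∣x-y) ∣x-y∣<m))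
      where
      ∣x-y∣<m : ∣ + x - + y ∣ ℕ.< m
      ∣x-y∣<m = subst (ℕ._< m) (cong ∣_∣ (sym (ℤP.m-n≡m⊖n x y)))
                  (ℕP.≤-<-trans (ℤP.∣m⊝n∣≤m⊔n x y) (ℕP.⊔-lub x<m y<m))

    _≈?_ : Decidable _≈_
    a ≈? b = map′ mk≈ _≈_.divides-difference (+ m ∣? a - b)

    module _ (prime : Prime m) where

      ≈0-product : ∀ {a b} → a * b ≈ 0ℤ → a ≈ 0ℤ ⊎ b ≈ 0ℤ
      ≈0-product {a} {b} ab≈0 with euclidsLemma ∣ a ∣ ∣ b ∣ prime m∣∣ab∣
        where
        m∣∣ab∣ : m ℕD.∣ ∣ a ∣ ℕ.* ∣ b ∣
        m∣∣ab∣ = subst (m ℕD.∣_) (ℤP.abs-* a b) (∣⇒∣ᵤ (≈0⇒∣ ab≈0))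
      ... | inj₁ m∣a = inj₁ (∣⇒≈0 (∣ᵤ⇒∣ m∣a))
      ... | inj₂ m∣b = inj₂ (∣⇒≈0 (∣ᵤ⇒∣ m∣b))

      *-cancelˡ-≈ : ∀ {a b c} → a ≉ 0ℤ → a * b ≈ a * c → b ≈ c
      *-cancelˡ-≈ {a} {b} {c} a≉0 (mk≈ m∣ab-ac) with ≈0-product (∣⇒≈0 (subst (+ m ∣_) (factor a b c) m∣ab-ac))
        where
        factor : ∀ a b c → a * b - a * c ≡ a * (b - c)
        factor = solve-∀
      ... | inj₁ a≈0   = ⊥-elim (a≉0 a≈0)
      ... | inj₂ b-c≈0 = mk≈ (≈0⇒∣ b-c≈0)

  -- Binomial coefficients, Fermat's little theorem and power sums

  [1+n]Cn≡1+n : ∀ n → suc n C n ≡ suc n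
  [1+n]Cn≡1+n n = begin
    suc n C n              ≡⟨ nCk≡nC[n∸k] (ℕP.n≤1+n n) ⟩
    suc n C (suc n ℕ.∸ n)  ≡⟨ cong (suc n C_) (ℕP.m+n∸n≡m 1 n) ⟩
    suc n C 1              ≡⟨ nC1≡n (suc n) ⟩
    suc n                  ∎
    where open ≡-Reasoning

  C-absorption : ∀ n k → suc k ℕ.* (suc n C suc k) ≡ suc n ℕ.* (n C k)
  C-absorption n       zero    = trans (ℕP.*-identityˡ _) (trans (nC1≡n (suc n)) (sym (ℕP.*-identityʳ (suc n))))
  C-absorption zero    (suc k) = ℕP.*-zeroʳ (suc (suc k))
  C-absorption (suc n) (suc k) = begin
    suc (suc k) ℕ.* (suc (suc n) C suc (suc k))
      ≡⟨ cong (suc (suc k) ℕ.*_) (nCk+nC[k+1]≡[n+1]C[k+1] (suc n) (suc k)) ⟨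
    suc (suc k) ℕ.* (A ℕ.+ B)
      ≡⟨ regroup k A B ⟩
    A ℕ.+ (suc k ℕ.* A ℕ.+ suc (suc k) ℕ.* B)
      ≡⟨ cong (A ℕ.+_) (cong₂ ℕ._+_ (C-absorption n k) (C-absorption n (suc k))) ⟩
    A ℕ.+ (suc n ℕ.* (n C k) ℕ.+ suc n ℕ.* (n C suc k))
      ≡⟨ cong (A ℕ.+_) (ℕP.*-distribˡ-+ (suc n) (n C k) _) ⟨
    A ℕ.+ suc n ℕ.* (n C k ℕ.+ n C suc k)
      ≡⟨ cong (λ a → A ℕ.+ suc n ℕ.* a) (nCk+nC[k+1]≡[n+1]C[k+1] n k) ⟩
    suc (suc n) ℕ.* A ∎
    where
    open ≡-Reasoning
    A = suc n C suc k
    B = suc n C suc (suc k)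
    regroup : ∀ k a b → (2 ℕ.+ k) ℕ.* (a ℕ.+ b) ≡ a ℕ.+ ((1 ℕ.+ k) ℕ.* a ℕ.+ (2 ℕ.+ k) ℕ.* b)
    regroup = ℕS.solve-∀

  binomial-theorem : ∀ n (x : ℤ) → (1ℤ + x) ^ n ≡ ∑[ k < suc n ] (+ (n C k) * x ^ k)
  binomial-theorem zero    x = refl
  binomial-theorem (suc n) x = begin
    (1ℤ + x) * (1ℤ + x) ^ n
      ≡⟨ cong (_*_ (1ℤ + x)) (binomial-theorem n x) ⟩
    (1ℤ + x) * ∑< (suc n) term
      ≡⟨ ℤP.*-distribʳ-+ (∑< (suc n) term) 1ℤ x ⟩
    1ℤ * ∑< (suc n) term + x * ∑< (suc n) term
      ≡⟨ cong₂ _+_ (ℤP.*-identityˡ (∑< (suc n) term)) (*-distribˡ-∑ (suc n) x term) ⟩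
    ∑< (suc n) term + ∑[ k < suc n ] (x * term k)
      ≡⟨ cong₂ _+_ drop-vanishing-term (∑-cong (suc n) λ k _ → raise (+ (n C k)) x (x ^ k)) ⟩
    (1ℤ + ∑< (suc n) (term ∘ suc)) + ∑< (suc n) raised
      ≡⟨ ℤP.+-assoc 1ℤ (∑< (suc n) (term ∘ suc)) (∑< (suc n) raised) ⟩
    1ℤ + (∑< (suc n) (term ∘ suc) + ∑< (suc n) raised)
      ≡⟨ cong (_+_ 1ℤ) (ℤP.+-comm (∑< (suc n) (term ∘ suc)) (∑< (suc n) raised)) ⟩
    1ℤ + (∑< (suc n) raised + ∑< (suc n) (term ∘ suc))
      ≡⟨ cong (_+_ 1ℤ) (∑-distrib-+ (suc n) raised (term ∘ suc)) ⟨
    1ℤ + ∑[ k < suc n ] (raised k + term (suc k))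
      ≡⟨ cong (_+_ 1ℤ) (∑-cong (suc n) λ k _ → pascal k) ⟩
    ∑[ k < suc (suc n) ] (+ (suc n C k) * x ^ k) ∎
    where
    open ≡-Reasoning
    term raised : ℕ → ℤ
    term k   = + (n C k) * x ^ k
    raised k = + (n C k) * x ^ suc k
    raise : ∀ c x y → x * (c * y) ≡ c * (x * y)
    raise = solve-∀
    drop-vanishing-term : ∑< (suc n) term ≡ 1ℤ + ∑< (suc n) (term ∘ suc)
    drop-vanishing-term = cong (_+_ 1ℤ) (sym (begin
      ∑< (suc n) (term ∘ suc)
        ≡⟨ ∑-last n (term ∘ suc) ⟩
      ∑< n (term ∘ suc) + term (suc n)
        ≡⟨ cong (λ c → ∑< n (term ∘ suc) + + c * x ^ suc n) (k>n⇒nCk≡0 (ℕP.n<1+n n)) ⟩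
      ∑< n (term ∘ suc) + 0ℤ * x ^ suc n
        ≡⟨ ℤP.+-identityʳ _ ⟩
      ∑< n (term ∘ suc) ∎))
    pascal : ∀ k → raised k + term (suc k) ≡ + (suc n C suc k) * x ^ suc k
    pascal k = begin
      + (n C k) * x ^ suc k + + (n C suc k) * x ^ suc k
        ≡⟨ ℤP.*-distribʳ-+ (x ^ suc k) (+ (n C k)) (+ (n C suc k)) ⟨
      (+ (n C k) + + (n C suc k)) * x ^ suc k
        ≡⟨ cong (_* x ^ suc k) (trans (ℤP.pos-+ (n C k) _) (cong +_ (nCk+nC[k+1]≡[n+1]C[k+1] n k))) ⟩
      + (suc n C suc k) * x ^ suc k ∎

  binomial-difference : ∀ k (x : ℤ) → (1ℤ + x) ^ suc k - x ^ suc k ≡ ∑[ j < k ] (+ (suc k C j) * x ^ j) + + suc k * x ^ k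
  binomial-difference k x = begin
    (1ℤ + x) ^ suc k - x ^ suc k
      ≡⟨ cong (_- x ^ suc k) (trans (binomial-theorem (suc k) x) (∑-last (suc k) term)) ⟩
    (∑< (suc k) term + term (suc k)) - x ^ suc k
      ≡⟨ cong (λ t → ∑< (suc k) term + t - x ^ suc k) top ⟩
    (∑< (suc k) term + x ^ suc k) - x ^ suc k
      ≡⟨ cancel (∑< (suc k) term) (x ^ suc k) ⟩
    ∑< (suc k) term
      ≡⟨ ∑-last k term ⟩
    ∑< k term + term k
      ≡⟨ cong (λ c → ∑< k term + + c * x ^ k) ([1+n]Cn≡1+n k) ⟩
    ∑< k term + + suc k * x ^ k ∎
    where
    open ≡-Reasoning
    term : ℕ → ℤ
    term j = + (suc k C j) * x ^ j
    top : term (suc k) ≡ x ^ suc k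
    top = trans (cong (λ c → + c * x ^ suc k) (nCn≡1 (suc k))) (ℤP.*-identityˡ _)
    cancel : ∀ a b → a + b - b ≡ a
    cancel = solve-∀

  0^k≡0 : ∀ {k} → 0 ℕ.< k → 0ℤ ^ k ≡ 0ℤ
  0^k≡0 {suc k} _ = ℤP.*-zeroˡ (0ℤ ^ k)

  prime[1+n]⇒n>0 : ∀ {n} → Prime (suc n) → 0 ℕ.< n
  prime[1+n]⇒n>0 {zero}  prime[1] = ⊥-elim (¬prime[1] prime[1])
  prime[1+n]⇒n>0 {suc n} _        = s≤s z≤n

  module PrimeModulus (n : ℕ) (prime : Prime (suc n)) where

    p : ℕ
    p = suc n

    open Congruence p public

    p∣pCk : ∀ k → 0 ℕ.< k → k ℕ.< p → + (p C k) ≈ 0ℤ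
    p∣pCk (suc k) _ k<p with euclidsLemma (suc k) (p C suc k) prime (ℕD.divides (n C k) absorption)
      where
      absorption : suc k ℕ.* (p C suc k) ≡ (n C k) ℕ.* p
      absorption = trans (C-absorption n k) (ℕP.*-comm p (n C k))
    ... | inj₁ p∣1+k  = ⊥-elim (positive≉0 (s≤s z≤n) k<p (∣⇒≈0 (∣ᵤ⇒∣ p∣1+k)))
    ... | inj₂ p∣pCk′ = ∣⇒≈0 (∣ᵤ⇒∣ p∣pCk′)

    fermat : ∀ x → (+ x) ^ p ≈ + x
    fermat zero    = ≈-reflexive (0^k≡0 {p} (s≤s z≤n))
    fermat (suc x) = begin
      (1ℤ + + x) ^ p
        ≡⟨ binomial-theorem p (+ x) ⟩
      ∑< (suc p) term
        ≡⟨ cong (_+_ 1ℤ) (∑-last n (term ∘ suc)) ⟩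
      1ℤ + (∑< n (term ∘ suc) + term p)
        ≈⟨ +-cong (≈-refl {1ℤ}) (+-cong inner≈0 (≈-reflexive outer)) ⟩
      1ℤ + (0ℤ + (+ x) ^ p)
        ≈⟨ +-cong (≈-refl {1ℤ}) (≈-trans (≈-reflexive (ℤP.+-identityˡ _)) (fermat x)) ⟩
      1ℤ + + x ∎
      where
      open ≈-Reasoning
      term : ℕ → ℤ
      term k = + (p C k) * (+ x) ^ k
      inner≈0 : ∑< n (term ∘ suc) ≈ 0ℤ
      inner≈0 = ≈-trans (∑-cong-≈ n λ k k<n → ≈-trans (*-cong (p∣pCk (suc k) (s≤s z≤n) (s≤s k<n)) ≈-refl)
                                                     (≈-reflexive (ℤP.*-zeroˡ ((+ x) ^ suc k))))
                        (≈-reflexive (∑-zero n))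
      outer : term p ≡ (+ x) ^ p
      outer = trans (cong (λ c → + c * (+ x) ^ p) (nCn≡1 p)) (ℤP.*-identityˡ _)

    fermat-unit : ∀ {x} → 0 ℕ.< x → x ℕ.< p → (+ x) ^ n ≈ 1ℤ
    fermat-unit {x} 0<x x<p = *-cancelˡ-≈ prime (positive≉0 0<x x<p)
      (≈-trans (fermat x) (≈-reflexive (sym (ℤP.*-identityʳ (+ x)))))

    n>0 : 0 ℕ.< n
    n>0 = prime[1+n]⇒n>0 prime

    powerSum : ℕ → ℤ
    powerSum k = ∑[ x < p ] (+ x) ^ k

    powerSum-top : powerSum n ≈ -1ℤ
    powerSum-top = begin
      0ℤ ^ n + ∑[ x < n ] (+ suc x) ^ n
        ≈⟨ +-cong (≈-reflexive (0^k≡0 n>0)) (∑-cong-≈ n λ x x<n → fermat-unit (s≤s z≤n) (s≤s x<n)) ⟩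
      0ℤ + ∑[ x < n ] 1ℤ
        ≡⟨ trans (ℤP.+-identityˡ _) (trans (∑-const n 1ℤ) (ℤP.*-identityʳ (+ n))) ⟩
      + p + -1ℤ
        ≈⟨ +-cong modulus≈0 (≈-refl { -1ℤ}) ⟩
      0ℤ + -1ℤ
        ≡⟨⟩
      -1ℤ ∎
      where open ≈-Reasoning

    powerSum-recurrence : ∀ k → ∑[ j < k ] (+ (suc k C j) * powerSum j) + + suc k * powerSum k
                              ≡ (+ p) ^ suc k - 0ℤ ^ suc k
    powerSum-recurrence k = begin
      ∑[ j < k ] (+ (suc k C j) * powerSum j) + + suc k * powerSum k
        ≡⟨ cong₂ _+_ (∑-cong k λ j _ → *-distribˡ-∑ p (+ (suc k C j)) (λ x → (+ x) ^ j))
                     (*-distribˡ-∑ p (+ suc k) (λ x → (+ x) ^ k)) ⟩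
      ∑[ j < k ] ∑[ x < p ] (+ (suc k C j) * (+ x) ^ j) + ∑[ x < p ] (+ suc k * (+ x) ^ k)
        ≡⟨ cong (_+ ∑[ x < p ] (+ suc k * (+ x) ^ k)) (∑-comm k p λ j x → + (suc k C j) * (+ x) ^ j) ⟩
      ∑[ x < p ] ∑[ j < k ] (+ (suc k C j) * (+ x) ^ j) + ∑[ x < p ] (+ suc k * (+ x) ^ k)
        ≡⟨ ∑-distrib-+ p (λ x → ∑[ j < k ] (+ (suc k C j) * (+ x) ^ j)) (λ x → + suc k * (+ x) ^ k) ⟨
      ∑[ x < p ] (∑[ j < k ] (+ (suc k C j) * (+ x) ^ j) + + suc k * (+ x) ^ k)
        ≡⟨ ∑-cong p (λ x _ → binomial-difference k (+ x)) ⟨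
      ∑[ x < p ] ((+ suc x) ^ suc k - (+ x) ^ suc k)
        ≡⟨ ∑-telescope p (λ x → (+ x) ^ suc k) ⟩
      (+ p) ^ suc k - 0ℤ ^ suc k
        ∎
      where open ≡-Reasoning

    powerSum-low : ∀ k → k ℕ.< n → powerSum k ≈ 0ℤ
    powerSum-low = <-rec _ step
      where
      step : ∀ k → (∀ {j} → j ℕ.< k → j ℕ.< n → powerSum j ≈ 0ℤ) → k ℕ.< n → powerSum k ≈ 0ℤ
      step k ih k<n = *-cancelˡ-≈ prime (positive≉0 (s≤s z≤n) (s≤s k<n)) (begin
        + suc k * powerSum k                    ≡⟨ isolate lower (+ suc k * powerSum k) ⟩
        (lower + + suc k * powerSum k) - lower  ≡⟨ cong (_- lower) (powerSum-recurrence k) ⟩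
        ((+ p) ^ suc k - 0ℤ ^ suc k) - lower    ≈⟨ -‿cong (-‿cong p^[1+k]≈0 (≈-refl {0ℤ ^ suc k})) lower≈0 ⟩
        (0ℤ - 0ℤ ^ suc k) - 0ℤ                  ≡⟨ cong (λ z → 0ℤ - z - 0ℤ) (0^k≡0 {suc k} (s≤s z≤n)) ⟩
        0ℤ                                      ≡⟨ ℤP.*-zeroʳ (+ suc k) ⟨
        + suc k * 0ℤ                            ∎)
        where
        open ≈-Reasoning
        lower : ℤ
        lower = ∑[ j < k ] (+ (suc k C j) * powerSum j)
        isolate : ∀ a b → b ≡ (a + b) - a
        isolate = solve-∀
        lower≈0 : lower ≈ 0ℤ
        lower≈0 = ≈-trans (∑-cong-≈ k λ j j<k → ≈-trans (*-cong (≈-refl {+ (suc k C j)}) (ih j<k (ℕP.<-trans j<k k<n)))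
                                                       (≈-reflexive (ℤP.*-zeroʳ (+ (suc k C j)))))
                          (≈-reflexive (∑-zero k))
        p^[1+k]≈0 : (+ p) ^ suc k ≈ 0ℤ
        p^[1+k]≈0 = ≈-trans (*-cong modulus≈0 (≈-refl {(+ p) ^ k})) (≈-reflexive (ℤP.*-zeroˡ ((+ p) ^ k)))

  -- Polynomials as coefficient vectors

  private variable
    k : ℕ

  ⟦_⟧ : Vec ℤ k → ℤ → ℤ
  ⟦ []     ⟧ x = 0ℤ
  ⟦ a ∷ as ⟧ x = a + x * ⟦ as ⟧ x

  monomial : ∀ k → Vec ℤ (suc k)
  monomial zero    = 1ℤ ∷ []
  monomial (suc k) = 0ℤ ∷ monomial k

  addConst : ℤ → Vec ℤ (suc k) → Vec ℤ (suc k)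
  addConst a (b ∷ bs) = a + b ∷ bs

  mulLinear : ℤ → Vec ℤ k → Vec ℤ (suc k)
  mulLinear g []       = 0ℤ ∷ []
  mulLinear g (a ∷ as) = - (g * a) ∷ addConst a (mulLinear g as)

  mulLinear^ : ℤ → ∀ r → Vec ℤ (suc k) → Vec ℤ (suc (r ℕ.+ k))
  mulLinear^ g zero    v = v
  mulLinear^ g (suc r) v = mulLinear g (mulLinear^ g r v)

  quot : ℤ → Vec ℤ (suc k) → Vec ℤ k
  quot r (a ∷ [])     = []
  quot r (a ∷ b ∷ bs) = ⟦ b ∷ bs ⟧ r ∷ quot r (b ∷ bs)

  ⟦monomial⟧ : ∀ k x → ⟦ monomial k ⟧ x ≡ x ^ k
  ⟦monomial⟧ zero    x = cong (_+_ 1ℤ) (ℤP.*-zeroʳ x)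
  ⟦monomial⟧ (suc k) x = trans (ℤP.+-identityˡ _) (cong (x *_) (⟦monomial⟧ k x))

  last-monomial : ∀ k → last (monomial k) ≡ 1ℤ
  last-monomial zero          = refl
  last-monomial (suc zero)    = refl
  last-monomial (suc (suc k)) = last-monomial (suc k)

  ⟦addConst⟧ : ∀ a (v : Vec ℤ (suc k)) x → ⟦ addConst a v ⟧ x ≡ a + ⟦ v ⟧ x
  ⟦addConst⟧ a (b ∷ bs) x = ℤP.+-assoc a b _

  ⟦mulLinear⟧ : ∀ g (v : Vec ℤ k) x → ⟦ mulLinear g v ⟧ x ≡ (x - g) * ⟦ v ⟧ x
  ⟦mulLinear⟧ g []       x = zero-poly g x
    where
    zero-poly : ∀ g x → 0ℤ + x * 0ℤ ≡ (x - g) * 0ℤ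
    zero-poly = solve-∀
  ⟦mulLinear⟧ g (a ∷ as) x = begin
    - (g * a) + x * ⟦ addConst a (mulLinear g as) ⟧ x
      ≡⟨ cong (λ t → - (g * a) + x * t) (⟦addConst⟧ a (mulLinear g as) x) ⟩
    - (g * a) + x * (a + ⟦ mulLinear g as ⟧ x)
      ≡⟨ cong (λ t → - (g * a) + x * (a + t)) (⟦mulLinear⟧ g as x) ⟩
    - (g * a) + x * (a + (x - g) * ⟦ as ⟧ x)
      ≡⟨ expand g a x (⟦ as ⟧ x) ⟩
    (x - g) * (a + x * ⟦ as ⟧ x) ∎
    where
    open ≡-Reasoning
    expand : ∀ g a x q → - (g * a) + x * (a + (x - g) * q) ≡ (x - g) * (a + x * q)
    expand = solve-∀

  ⟦mulLinear^⟧ : ∀ g r (v : Vec ℤ (suc k)) x → ⟦ mulLinear^ g r v ⟧ x ≡ (x - g) ^ r * ⟦ v ⟧ x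
  ⟦mulLinear^⟧ g zero    v x = sym (ℤP.*-identityˡ _)
  ⟦mulLinear^⟧ g (suc r) v x = begin
    ⟦ mulLinear g (mulLinear^ g r v) ⟧ x   ≡⟨ ⟦mulLinear⟧ g (mulLinear^ g r v) x ⟩
    (x - g) * ⟦ mulLinear^ g r v ⟧ x       ≡⟨ cong ((x - g) *_) (⟦mulLinear^⟧ g r v x) ⟩
    (x - g) * ((x - g) ^ r * ⟦ v ⟧ x)      ≡⟨ ℤP.*-assoc (x - g) _ _ ⟨
    (x - g) ^ suc r * ⟦ v ⟧ x              ∎
    where open ≡-Reasoning

  last-mulLinear : ∀ g (v : Vec ℤ (suc k)) → last (mulLinear g v) ≡ last v
  last-mulLinear g (a ∷ [])     = ℤP.+-identityʳ a
  last-mulLinear g (a ∷ b ∷ bs) = last-mulLinear g (b ∷ bs)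

  last-mulLinear^ : ∀ g r (v : Vec ℤ (suc k)) → last (mulLinear^ g r v) ≡ last v
  last-mulLinear^ g zero    v = refl
  last-mulLinear^ g (suc r) v = trans (last-mulLinear g (mulLinear^ g r v)) (last-mulLinear^ g r v)

  factor-theorem : ∀ r (v : Vec ℤ (suc k)) x → ⟦ v ⟧ x - ⟦ v ⟧ r ≡ (x - r) * ⟦ quot r v ⟧ x
  factor-theorem r (a ∷ [])     x = constant a r x
    where
    constant : ∀ a r x → (a + x * 0ℤ) - (a + r * 0ℤ) ≡ (x - r) * 0ℤ
    constant = solve-∀
  factor-theorem r (a ∷ b ∷ bs) x = begin
    (a + x * ⟦ v ⟧ x) - (a + r * ⟦ v ⟧ r)
      ≡⟨ split a r x (⟦ v ⟧ x) (⟦ v ⟧ r) ⟩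
    (x - r) * ⟦ v ⟧ r + x * (⟦ v ⟧ x - ⟦ v ⟧ r)
      ≡⟨ cong (λ t → (x - r) * ⟦ v ⟧ r + x * t) (factor-theorem r v x) ⟩
    (x - r) * ⟦ v ⟧ r + x * ((x - r) * ⟦ quot r v ⟧ x)
      ≡⟨ merge r x (⟦ v ⟧ r) (⟦ quot r v ⟧ x) ⟩
    (x - r) * (⟦ v ⟧ r + x * ⟦ quot r v ⟧ x) ∎
    where
    open ≡-Reasoning
    v = b ∷ bs
    split : ∀ a r x s t → (a + x * s) - (a + r * t) ≡ (x - r) * t + x * (s - t)
    split = solve-∀
    merge : ∀ r x t q → (x - r) * t + x * ((x - r) * q) ≡ (x - r) * (t + x * q)
    merge = solve-∀

  last-quot : ∀ r (v : Vec ℤ (suc (suc k))) → last (quot r v) ≡ last v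
  last-quot r (a ∷ b ∷ [])     = trans (cong (_+_ b) (ℤP.*-zeroʳ r)) (ℤP.+-identityʳ b)
  last-quot r (a ∷ b ∷ c ∷ cs) = last-quot r (b ∷ c ∷ cs)

  module PolynomialsModP (n : ℕ) (prime : Prime (suc n)) where

    open PrimeModulus n prime public

    private
      ∑-shift : ∀ j a (as : Vec ℤ k) →
                ∑[ x < p ] (+ x) ^ j * ⟦ a ∷ as ⟧ (+ x) ≡ a * powerSum j + ∑[ x < p ] (+ x) ^ suc j * ⟦ as ⟧ (+ x)
      ∑-shift j a as = begin
        ∑[ x < p ] (+ x) ^ j * ⟦ a ∷ as ⟧ (+ x)
          ≡⟨ ∑-cong p (λ x _ → distribute a (+ x) ((+ x) ^ j) (⟦ as ⟧ (+ x))) ⟩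
        ∑[ x < p ] (a * (+ x) ^ j + (+ x) ^ suc j * ⟦ as ⟧ (+ x))
          ≡⟨ ∑-distrib-+ p (λ x → a * (+ x) ^ j) (λ x → (+ x) ^ suc j * ⟦ as ⟧ (+ x)) ⟩
        ∑[ x < p ] a * (+ x) ^ j + ∑[ x < p ] (+ x) ^ suc j * ⟦ as ⟧ (+ x)
          ≡⟨ cong (_+ ∑[ x < p ] (+ x) ^ suc j * ⟦ as ⟧ (+ x)) (*-distribˡ-∑ p a (λ x → (+ x) ^ j)) ⟨
        a * powerSum j + ∑[ x < p ] (+ x) ^ suc j * ⟦ as ⟧ (+ x) ∎
        where
        open ≡-Reasoning
        distribute : ∀ a x xʲ q → xʲ * (a + x * q) ≡ a * xʲ + (x * xʲ) * q
        distribute = solve-∀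

      ∑-shifted-nil : ∀ j → ∑[ x < p ] (+ x) ^ j * ⟦ [] ⟧ (+ x) ≡ 0ℤ
      ∑-shifted-nil j = trans (∑-cong p λ x _ → ℤP.*-zeroʳ ((+ x) ^ j)) (∑-zero p)

      ∑-shifted-low : ∀ (v : Vec ℤ k) j → j ℕ.+ k ℕ.≤ n → ∑[ x < p ] (+ x) ^ j * ⟦ v ⟧ (+ x) ≈ 0ℤ
      ∑-shifted-low []       j _ = ≈-reflexive (∑-shifted-nil j)
      ∑-shifted-low (a ∷ as) j j+k<n = begin
        ∑[ x < p ] (+ x) ^ j * ⟦ a ∷ as ⟧ (+ x)
          ≡⟨ ∑-shift j a as ⟩
        a * powerSum j + ∑[ x < p ] (+ x) ^ suc j * ⟦ as ⟧ (+ x)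
          ≈⟨ +-cong (*-cong (≈-refl {a}) (powerSum-low j j<n))
                    (∑-shifted-low as (suc j) (subst (ℕ._≤ n) (ℕP.+-suc j _) j+k<n)) ⟩
        a * 0ℤ + 0ℤ
          ≡⟨ trans (ℤP.+-identityʳ _) (ℤP.*-zeroʳ a) ⟩
        0ℤ ∎
        where
        open ≈-Reasoning
        j<n = ℕP.<-≤-trans (ℕP.m<m+n j (s≤s z≤n)) j+k<n

      ∑-shifted-top : ∀ (v : Vec ℤ (suc k)) j → j ℕ.+ k ≡ n → ∑[ x < p ] (+ x) ^ j * ⟦ v ⟧ (+ x) ≈ - last v
      ∑-shifted-top (a ∷ []) j j+0≡n = begin
        ∑[ x < p ] (+ x) ^ j * ⟦ a ∷ [] ⟧ (+ x)
          ≡⟨ ∑-shift j a [] ⟩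
        a * powerSum j + ∑[ x < p ] (+ x) ^ suc j * 0ℤ
          ≈⟨ +-cong (*-cong (≈-refl {a}) (subst (λ i → powerSum i ≈ -1ℤ) (trans (sym j+0≡n) (ℕP.+-identityʳ j))
                                                powerSum-top))
                    (≈-reflexive (∑-shifted-nil (suc j))) ⟩
        a * -1ℤ + 0ℤ
          ≡⟨ trans (ℤP.+-identityʳ _) (trans (ℤP.*-comm a -1ℤ) (ℤP.-1*i≡-i a)) ⟩
        - a ∎
        where open ≈-Reasoning
      ∑-shifted-top (a ∷ b ∷ bs) j j+k≡n = begin
        ∑[ x < p ] (+ x) ^ j * ⟦ a ∷ b ∷ bs ⟧ (+ x)
          ≡⟨ ∑-shift j a (b ∷ bs) ⟩
        a * powerSum j + ∑[ x < p ] (+ x) ^ suc j * ⟦ b ∷ bs ⟧ (+ x)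
          ≈⟨ +-cong (*-cong (≈-refl {a}) (powerSum-low j j<n))
                    (∑-shifted-top (b ∷ bs) (suc j) (trans (sym (ℕP.+-suc j _)) j+k≡n)) ⟩
        a * 0ℤ + - last (b ∷ bs)
          ≡⟨ trans (cong (_+ - last (b ∷ bs)) (ℤP.*-zeroʳ a)) (ℤP.+-identityˡ _) ⟩
        - last (b ∷ bs) ∎
        where
        open ≈-Reasoning
        j<n = subst (j ℕ.<_) j+k≡n (ℕP.m<m+n j (s≤s z≤n))

    ∑⟦⟧-low : ∀ (v : Vec ℤ k) → k ℕ.≤ n → ∑[ x < p ] ⟦ v ⟧ (+ x) ≈ 0ℤ
    ∑⟦⟧-low v k≤n =
      ≈-trans (≈-reflexive (∑-cong p λ x _ → sym (ℤP.*-identityˡ (⟦ v ⟧ (+ x))))) (∑-shifted-low v 0 k≤n)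

    ∑⟦⟧-top : ∀ (v : Vec ℤ (suc n)) → ∑[ x < p ] ⟦ v ⟧ (+ x) ≈ - last v
    ∑⟦⟧-top v =
      ≈-trans (≈-reflexive (∑-cong p λ x _ → sym (ℤP.*-identityˡ (⟦ v ⟧ (+ x))))) (∑-shifted-top v 0 refl)

    ∑-[x-a]^k≈0 : ∀ a k → k ℕ.< n → ∑[ x < p ] (+ x - a) ^ k ≈ 0ℤ
    ∑-[x-a]^k≈0 a k k<n = ≈-trans (≈-reflexive (∑-cong p λ x _ → sym (⟦[x-a]^k⟧ (+ x))))
                                  (∑⟦⟧-low (mulLinear^ a k (1ℤ ∷ [])) (subst (ℕ._< n) (sym (ℕP.+-identityʳ k)) k<n))
      where
      ⟦[x-a]^k⟧ : ∀ x → ⟦ mulLinear^ a k (1ℤ ∷ []) ⟧ x ≡ (x - a) ^ k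
      ⟦[x-a]^k⟧ x = begin
        ⟦ mulLinear^ a k (1ℤ ∷ []) ⟧ x   ≡⟨ ⟦mulLinear^⟧ a k (1ℤ ∷ []) x ⟩
        (x - a) ^ k * (1ℤ + x * 0ℤ)      ≡⟨ cong (λ t → (x - a) ^ k * (1ℤ + t)) (ℤP.*-zeroʳ x) ⟩
        (x - a) ^ k * 1ℤ                 ≡⟨ ℤP.*-identityʳ _ ⟩
        (x - a) ^ k                      ∎
        where open ≡-Reasoning

    roots : Vec ℤ k → ℤ
    roots v = ∑[ x < p ] 𝟙 (⟦ v ⟧ (+ x) ≈? 0ℤ)

    root-bound : ∀ (v : Vec ℤ (suc k)) → last v ≉ 0ℤ → roots v ≤ + k
    root-bound v lead≉0 with anyUpTo? (λ x → ⟦ v ⟧ (+ x) ≈? 0ℤ) p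
    ... | no no-root = ℤP.≤-trans (ℤP.≤-reflexive roots≡0) (+≤+ z≤n)
      where
      roots≡0 : roots v ≡ 0ℤ
      roots≡0 = trans (∑-cong p λ x x<p → 𝟙-no (⟦ v ⟧ (+ x) ≈? 0ℤ) λ root → no-root (x , x<p , root)) (∑-zero p)
    root-bound {zero} (a ∷ []) a≉0 | yes (r , _ , root) =
      ⊥-elim (a≉0 (≈-trans (≈-reflexive (sym (trans (cong (_+_ a) (ℤP.*-zeroʳ (+ r))) (ℤP.+-identityʳ a)))) root))
    root-bound {suc k} v lead≉0 | yes (r , r<p , root) = begin
      roots v
        ≤⟨ ∑-mono-≤ p (λ x x<p → 𝟙-≤-+ (⟦ v ⟧ (+ x) ≈? 0ℤ) (x ℕP.≟ r) (⟦ q ⟧ (+ x) ≈? 0ℤ)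
                                       (root-split x<p)) ⟩
      ∑[ x < p ] (𝟙 (x ℕP.≟ r) + 𝟙 (⟦ q ⟧ (+ x) ≈? 0ℤ))
        ≡⟨ ∑-distrib-+ p (λ x → 𝟙 (x ℕP.≟ r)) (λ x → 𝟙 (⟦ q ⟧ (+ x) ≈? 0ℤ)) ⟩
      ∑[ x < p ] 𝟙 (x ℕP.≟ r) + roots q
        ≡⟨ cong (_+ roots q) (∑-𝟙-≡ p r<p) ⟩
      1ℤ + roots q
        ≤⟨ ℤP.+-monoʳ-≤ 1ℤ (root-bound q (λ q≈0 → lead≉0 (≈-trans (≈-reflexive (sym (last-quot (+ r) v))) q≈0))) ⟩
      + suc k ∎
      where
      open ℤP.≤-Reasoning
      q = quot (+ r) v
      root-split : ∀ {x} → x ℕ.< p → ⟦ v ⟧ (+ x) ≈ 0ℤ → x ≡ r ⊎ ⟦ q ⟧ (+ x) ≈ 0ℤ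
      root-split {x} x<p vx≈0
        with ≈0-product prime (≈-trans (≈-reflexive (sym (factor-theorem (+ r) v (+ x)))) (-‿cong vx≈0 root))
      ... | inj₁ x-r≈0 = inj₁ (residue-injective x<p r<p (-≈0⇒≈ {+ x} {+ r} x-r≈0))
      ... | inj₂ qx≈0  = inj₂ qx≈0

    roots[xᵏ-1]≤k : ∀ k → 0 ℕ.< k → ∑[ x < p ] 𝟙 ((+ x) ^ k - 1ℤ ≈? 0ℤ) ≤ + k
    roots[xᵏ-1]≤k (suc k) _ = begin
      ∑[ x < p ] 𝟙 ((+ x) ^ suc k - 1ℤ ≈? 0ℤ)
        ≡⟨ ∑-cong p (λ x _ → cong (λ t → 𝟙 (t ≈? 0ℤ)) (sym (⟦xᵏ⁺¹-1⟧ (+ x)))) ⟩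
      roots xᵏ⁺¹-1
        ≤⟨ root-bound xᵏ⁺¹-1 1≉0 ⟩
      + suc k ∎
      where
      open ℤP.≤-Reasoning
      xᵏ⁺¹-1 : Vec ℤ (suc (suc k))
      xᵏ⁺¹-1 = -1ℤ ∷ monomial k
      ⟦xᵏ⁺¹-1⟧ : ∀ x → ⟦ xᵏ⁺¹-1 ⟧ x ≡ x ^ suc k - 1ℤ
      ⟦xᵏ⁺¹-1⟧ x = trans (cong (λ t → -1ℤ + x * t) (⟦monomial⟧ k x)) (ℤP.+-comm -1ℤ (x ^ suc k))
      1≉0 : last xᵏ⁺¹-1 ≉ 0ℤ
      1≉0 = subst (_≉ 0ℤ) (sym (last-monomial k)) (positive≉0 (s≤s z≤n) (s≤s n>0))

  -- The Legendre symbol and Euler's criterion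

  ≡ᵇ-false⇒≢ : ∀ {m n} → (m ℕ.≡ᵇ n) ≡ false → m ≢ n
  ≡ᵇ-false⇒≢ {m} m≢ᵇn refl = subst Bool.T m≢ᵇn (ℕP.≡⇒≡ᵇ m m refl)

  module _ (p : ℕ) .{{_ : NonZero p}} where

    IsSquareMod : ℕ → Set
    IsSquareMod u = ∃ λ y → y ℕ.< p × (y ℕ.* y) % p ≡ u % p

    squares-to : ℕ → ℕ → Bool
    squares-to u y = (y ℕ.* y) % p ℕ.≡ᵇ u % p

    data LegendreSpec (u : ℕ) : ℤ → Set where
      divisible  : u % p ≡ 0 → LegendreSpec u 0ℤ
      residue    : u % p ≢ 0 → IsSquareMod u → LegendreSpec u 1ℤ
      nonresidue : u % p ≢ 0 → ¬ IsSquareMod u → LegendreSpec u -1ℤ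

    any-square⇒IsSquareMod : ∀ u → any (squares-to u) (upTo p) ≡ true → IsSquareMod u
    any-square⇒IsSquareMod u found with find (any⁻ (squares-to u) (upTo p) (subst Bool.T (sym found) _))
    ... | y , y∈upTo , y²≡ᵇu = y , ∈-upTo⁻ y∈upTo , ℕP.≡ᵇ⇒≡ _ _ y²≡ᵇu

    no-square⇒¬IsSquareMod : ∀ u → any (squares-to u) (upTo p) ≡ false → ¬ IsSquareMod u
    no-square⇒¬IsSquareMod u none (y , y<p , y²≡u) =
      subst Bool.T none (any⁺ (squares-to u) (lose (∈-upTo⁺ y<p) (ℕP.≡⇒≡ᵇ _ _ y²≡u)))

    -- does (m ≟ n) computes to m ≡ᵇ n, so these are literally the tests made by legendre.
    legendre-spec : ∀ u → LegendreSpec u (legendre p u)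
    legendre-spec u with (u % p) ℕ.≡ᵇ 0 in u≡ᵇ0
    ... | true  = divisible (ℕP.≡ᵇ⇒≡ (u % p) 0 (subst Bool.T (sym u≡ᵇ0) _))
    ... | false with any (squares-to u) (upTo p) in found
    ...   | true  = residue (≡ᵇ-false⇒≢ u≡ᵇ0) (any-square⇒IsSquareMod u found)
    ...   | false = nonresidue (≡ᵇ-false⇒≢ u≡ᵇ0) (no-square⇒¬IsSquareMod u found)

    legendre-bounded : ∀ u → -1ℤ ≤ legendre p u × legendre p u ≤ 1ℤ
    legendre-bounded u with legendre p u | legendre-spec u
    ... | _ | divisible _    = -≤+ , +≤+ z≤n
    ... | _ | residue _ _    = -≤+ , ℤP.≤-refl
    ... | _ | nonresidue _ _ = ℤP.≤-refl , -≤+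

  ^-distrib-* : ∀ (a b : ℤ) n → (a * b) ^ n ≡ a ^ n * b ^ n
  ^-distrib-* a b zero    = refl
  ^-distrib-* a b (suc n) = trans (cong ((a * b) *_) (^-distrib-* a b n)) (*-interchange a b (a ^ n) (b ^ n))

  ^-square : ∀ (a : ℤ) d → (a * a) ^ d ≡ a ^ (d ℕ.+ d)
  ^-square a d = trans (^-distrib-* a a d) (sym (ℤP.^-distribˡ-+-* a d d))

  module EulerCriterion (d : ℕ) (prime : Prime (suc (d ℕ.+ d))) where

    open PolynomialsModP (d ℕ.+ d) prime public

    d>0 : 0 ℕ.< d
    d>0 = half-positive n>0
      where
      half-positive : ∀ {d} → 0 ℕ.< d ℕ.+ d → 0 ℕ.< d
      half-positive {suc d} _ = s≤s z≤n

    square^d≈1 : ∀ {y} → 0 ℕ.< y → y ℕ.< p → (+ ((y ℕ.* y) % p)) ^ d ≈ 1ℤ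
    square^d≈1 {y} 0<y y<p = begin
      (+ ((y ℕ.* y) % p)) ^ d   ≈⟨ ^-cong d (%-≈ (y ℕ.* y)) ⟩
      (+ (y ℕ.* y)) ^ d         ≡⟨ cong (_^ d) (ℤP.pos-* y y) ⟩
      (+ y * + y) ^ d           ≡⟨ ^-square (+ y) d ⟩
      (+ y) ^ (d ℕ.+ d)         ≈⟨ fermat-unit 0<y y<p ⟩
      1ℤ                        ∎
      where open ≈-Reasoning

    squares-distinct : ∀ {x y} → 0 ℕ.< x ℕ.+ y → x ℕ.+ y ℕ.< p → (x ℕ.* x) % p ≡ (y ℕ.* y) % p → x ≡ y
    squares-distinct {x} {y} 0<x+y x+y<p x²≡y² with ≈0-product prime difference-of-squares≈0
      where
      difference-of-squares≈0 : (+ x - + y) * (+ x + + y) ≈ 0ℤ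
      difference-of-squares≈0 = begin
        (+ x - + y) * (+ x + + y)   ≡⟨ factor (+ x) (+ y) ⟩
        + x * + x - + y * + y       ≡⟨ cong₂ _-_ (ℤP.pos-* x x) (ℤP.pos-* y y) ⟨
        + (x ℕ.* x) - + (y ℕ.* y)   ≈⟨ -‿cong (%-≡⇒≈ x²≡y²) (≈-refl {+ (y ℕ.* y)}) ⟩
        + (y ℕ.* y) - + (y ℕ.* y)   ≡⟨ ℤP.+-inverseʳ (+ (y ℕ.* y)) ⟩
        0ℤ                          ∎
        where
        open ≈-Reasoning
        factor : ∀ a b → (a - b) * (a + b) ≡ a * a - b * b
        factor = solve-∀
    ... | inj₁ x-y≈0 =
      residue-injective (ℕP.≤-<-trans (ℕP.m≤m+n x y) x+y<p) (ℕP.≤-<-trans (ℕP.m≤n+m y x) x+y<p) (-≈0⇒≈ x-y≈0)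
    ... | inj₂ x+y≈0 = ⊥-elim (positive≉0 0<x+y x+y<p (≈-trans (≈-reflexive (ℤP.pos-+ x y)) x+y≈0))

    -- Otherwise 1², …, d² and u would be d + 1 distinct roots of X^d - 1.
    nonsquare^d≉1 : ∀ {u} → u ℕ.< p → ¬ IsSquareMod p u → (+ u) ^ d ≉ 1ℤ
    nonsquare^d≉1 {u} u<p nonsquare u^d≈1 = ℕP.<-irrefl refl (ℤP.drop‿+≤+ (begin
      + suc d
        ≤⟨ count-≥-injection p root? (suc d) candidate candidate-root candidates-distinct ⟩
      ∑[ x < p ] 𝟙 ((+ x) ^ d - 1ℤ ≈? 0ℤ)
        ≤⟨ roots[xᵏ-1]≤k d d>0 ⟩
      + d ∎))
      where
      open ℤP.≤-Reasoning
      root? : ∀ x → Dec ((+ x) ^ d - 1ℤ ≈ 0ℤ)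
      root? x = (+ x) ^ d - 1ℤ ≈? 0ℤ
      candidate : ℕ → ℕ
      candidate zero    = u
      candidate (suc i) = (suc i ℕ.* suc i) % p
      1+i<p : ∀ {i} → i ℕ.< d → suc i ℕ.< p
      1+i<p i<d = s≤s (ℕP.≤-trans i<d (ℕP.m≤m+n d d))
      candidate-root : ∀ i → i ℕ.< suc d → candidate i ℕ.< p × (+ candidate i) ^ d - 1ℤ ≈ 0ℤ
      candidate-root zero    _         = u<p , -‿cong u^d≈1 ≈-refl
      candidate-root (suc i) (s≤s i<d) =
        ℕDM.m%n<n (suc i ℕ.* suc i) p , -‿cong (square^d≈1 (s≤s z≤n) (1+i<p i<d)) ≈-refl
      u-nonsquare : ∀ {i} → i ℕ.< d → u ≢ (suc i ℕ.* suc i) % p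
      u-nonsquare {i} i<d u≡i² = nonsquare (suc i , 1+i<p i<d , trans (sym u≡i²) (sym (ℕDM.m<n⇒m%n≡m u<p)))
      candidates-distinct : ∀ {i j} → i ℕ.< suc d → j ℕ.< suc d → candidate i ≡ candidate j → i ≡ j
      candidates-distinct {zero}  {zero}  _         _         _   = refl
      candidates-distinct {zero}  {suc j} _         (s≤s j<d) u≡j² = ⊥-elim (u-nonsquare j<d u≡j²)
      candidates-distinct {suc i} {zero}  (s≤s i<d) _         i²≡u = ⊥-elim (u-nonsquare i<d (sym i²≡u))
      candidates-distinct {suc i} {suc j} (s≤s i<d) (s≤s j<d) i²≡j² =
        squares-distinct (s≤s z≤n) (s≤s (ℕP.+-mono-≤ i<d j<d)) i²≡j²

    nonsquare-positive : ∀ {u} → ¬ IsSquareMod p u → 0 ℕ.< u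
    nonsquare-positive {zero}  nonsquare = ⊥-elim (nonsquare (0 , s≤s z≤n , refl))
    nonsquare-positive {suc u} _         = s≤s z≤n

    nonsquare^d≈-1 : ∀ {u} → u ℕ.< p → ¬ IsSquareMod p u → (+ u) ^ d ≈ -1ℤ
    nonsquare^d≈-1 {u} u<p nonsquare with ≈0-product prime [w-1][w+1]≈0
      where
      w = (+ u) ^ d
      0<u = nonsquare-positive nonsquare
      [w-1][w+1]≈0 : (w - 1ℤ) * (w + 1ℤ) ≈ 0ℤ
      [w-1][w+1]≈0 = begin
        (w - 1ℤ) * (w + 1ℤ)       ≡⟨ factor w ⟩
        w * w - 1ℤ                ≡⟨ cong (_- 1ℤ) (ℤP.^-distribˡ-+-* (+ u) d d) ⟨
        (+ u) ^ (d ℕ.+ d) - 1ℤ    ≈⟨ -‿cong (fermat-unit 0<u u<p) (≈-refl {1ℤ}) ⟩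
        0ℤ                        ∎
        where
        open ≈-Reasoning
        factor : ∀ w → (w - 1ℤ) * (w + 1ℤ) ≡ w * w - 1ℤ
        factor = solve-∀
    ... | inj₁ w-1≈0 = ⊥-elim (nonsquare^d≉1 u<p nonsquare (-≈0⇒≈ w-1≈0))
    ... | inj₂ w+1≈0 = -≈0⇒≈ w+1≈0

    euler-criterion : ∀ {u} → u ℕ.< p → legendre p u ≈ (+ u) ^ d
    euler-criterion {u} u<p with legendre p u | legendre-spec p u
    ... | _ | divisible u%p≡0 = ≈-reflexive (sym (trans (cong (λ v → (+ v) ^ d) u≡0) (0^k≡0 d>0)))
      where
      u≡0 : u ≡ 0
      u≡0 = trans (sym (ℕDM.m<n⇒m%n≡m u<p)) u%p≡0
    ... | _ | residue u%p≢0 (zero , _ , 0≡u%p) = ⊥-elim (u%p≢0 (sym 0≡u%p))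
    ... | _ | residue _ (suc y , y<p , y²≡u%p) = ≈-sym (begin
      (+ u) ^ d
        ≡⟨ cong (λ v → (+ v) ^ d) (trans (sym (ℕDM.m<n⇒m%n≡m u<p)) (sym y²≡u%p)) ⟩
      (+ ((suc y ℕ.* suc y) % p)) ^ d
        ≈⟨ square^d≈1 (s≤s z≤n) y<p ⟩
      1ℤ ∎)
      where open ≈-Reasoning
    ... | _ | nonresidue _ nonsquare = ≈-sym (nonsquare^d≈-1 u<p nonsquare)

  -- The character sums of P

  sum-map-applyUpTo : ∀ n (h g : ℕ → ℕ) → + sum (map h (applyUpTo g n)) ≡ ∑[ x < n ] + h (g x)
  sum-map-applyUpTo zero    h g = refl
  sum-map-applyUpTo (suc n) h g =
    trans (ℤP.pos-+ (h (g 0)) _) (cong (_+_ (+ h (g 0))) (sum-map-applyUpTo n h (g ∘ suc)))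

  foldr-map-applyUpTo : ∀ n (h : ℕ → ℤ) (g : ℕ → ℕ) → List.foldr _+_ 0ℤ (map h (applyUpTo g n)) ≡ ∑[ x < n ] h (g x)
  foldr-map-applyUpTo zero    h g = refl
  foldr-map-applyUpTo (suc n) h g = cong (_+_ (h (g 0))) (foldr-map-applyUpTo n h (g ∘ suc))

  sum-tabulate-*ˡ : ∀ {k} c (f : Fin k → ℕ) → sum (List.tabulate (λ i → c ℕ.* f i)) ≡ c ℕ.* sum (List.tabulate f)
  sum-tabulate-*ˡ {zero}  c f = sym (ℕP.*-zeroʳ c)
  sum-tabulate-*ˡ {suc k} c f =
    trans (cong (c ℕ.* f Fin.zero ℕ.+_) (sum-tabulate-*ˡ c (f ∘ Fin.suc))) (sym (ℕP.*-distribˡ-+ c (f Fin.zero) _))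

  sum-monomials≡⟦⟧ : ∀ {k} (f : Fin k → ℕ) x →
                     + sum (map (λ i → f i ℕ.* x ℕ.^ toℕ i) (allFin k)) ≡ ⟦ Vec.tabulate (+_ ∘ f) ⟧ (+ x)
  sum-monomials≡⟦⟧ {k} f x =
    trans (cong (+_ ∘ sum) (map-tabulate (λ i → i) (λ i → f i ℕ.* x ℕ.^ toℕ i))) (horner f)
    where
    horner : ∀ {k} (f : Fin k → ℕ) →
             + sum (List.tabulate (λ i → f i ℕ.* x ℕ.^ toℕ i)) ≡ ⟦ Vec.tabulate (+_ ∘ f) ⟧ (+ x)
    horner {zero}  f = refl
    horner {suc k} f = begin
      + (f₀ ℕ.* 1 ℕ.+ sum (List.tabulate (λ i → f (Fin.suc i) ℕ.* (x ℕ.* x ℕ.^ toℕ i))))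
        ≡⟨ cong (λ s → + (f₀ ℕ.* 1 ℕ.+ s)) (trans (cong sum (tabulate-cong λ i → x∙yz≈y∙xz (f (Fin.suc i)) x _))
                                                  (sum-tabulate-*ˡ {k} x (λ i → f (Fin.suc i) ℕ.* x ℕ.^ toℕ i))) ⟩
      + (f₀ ℕ.* 1 ℕ.+ x ℕ.* rest)
        ≡⟨ trans (ℤP.pos-+ (f₀ ℕ.* 1) _) (cong₂ _+_ (cong +_ (ℕP.*-identityʳ f₀)) (ℤP.pos-* x rest)) ⟩
      + f₀ + + x * + rest
        ≡⟨ cong (λ t → + f₀ + + x * t) (horner (f ∘ Fin.suc)) ⟩
      + f₀ + + x * ⟦ Vec.tabulate (+_ ∘ f ∘ Fin.suc) ⟧ (+ x)
        ∎
      where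
      open ≡-Reasoning
      f₀ = f Fin.zero
      rest = sum (List.tabulate (λ i → f (Fin.suc i) ℕ.* x ℕ.^ toℕ i))

  last-tabulate : ∀ {k} (f : Fin (suc k) → ℤ) → last (Vec.tabulate f) ≡ f (fromℕ k)
  last-tabulate {zero}  f = refl
  last-tabulate {suc k} f = last-tabulate (f ∘ Fin.suc)

  *-sign-bounds : ∀ a {X} → -1ℤ ≤ X × X ≤ 1ℤ → - + a ≤ + a * X × + a * X ≤ + a
  *-sign-bounds a {X} (-1≤X , X≤1) = lower , upper
    where
    open ℤP.≤-Reasoning
    lower = begin
      - + a       ≡⟨ trans (ℤP.*-comm (+ a) -1ℤ) (ℤP.-1*i≡-i (+ a)) ⟨
      + a * -1ℤ   ≤⟨ ℤP.*-monoˡ-≤-nonNeg (+ a) -1≤X ⟩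
      + a * X     ∎
    upper = begin
      + a * X     ≤⟨ ℤP.*-monoˡ-≤-nonNeg (+ a) X≤1 ⟩
      + a * 1ℤ    ≡⟨ ℤP.*-identityʳ (+ a) ⟩
      + a         ∎

  1-X≤[a+𝟙[a≡0]][1-X] : ∀ a {X} → X ≤ 1ℤ → 1ℤ - X ≤ (+ a + 𝟙 (a ℕP.≟ 0)) * (1ℤ - X)
  1-X≤[a+𝟙[a≡0]][1-X] a {X} X≤1 = begin
    1ℤ - X
      ≡⟨ ℤP.*-identityˡ (1ℤ - X) ⟨
    1ℤ * (1ℤ - X)
      ≤⟨ ℤP.*-monoʳ-≤-nonNeg (1ℤ - X) ⦃ nonNegative (ℤP.i≤j⇒0≤j-i X≤1) ⦄ (1≤a+𝟙[a≡0] a) ⟩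
    (+ a + 𝟙 (a ℕP.≟ 0)) * (1ℤ - X) ∎
    where
    open ℤP.≤-Reasoning
    1≤a+𝟙[a≡0] : ∀ a → 1ℤ ≤ + a + 𝟙 (a ℕP.≟ 0)
    1≤a+𝟙[a≡0] zero    = ℤP.≤-refl
    1≤a+𝟙[a≡0] (suc a) = +≤+ (s≤s z≤n)

  i≤+∣i∣ : ∀ i → i ≤ + ∣ i ∣
  i≤+∣i∣ (+ n)    = ℤP.≤-refl
  i≤+∣i∣ -[1+ n ] = -≤+

  two-valued : ∀ {t q c : ℤ} → t ≡ - c ⊎ t ≡ q - c → t ≡ q * 𝟙 (t ℤP.≟ q - c) - c
  two-valued {t} {q} {c} t∈[-c,q-c] with t ℤP.≟ q - c | t∈[-c,q-c]
  ... | yes t≡q-c | _          = trans t≡q-c (cong (_- c) (sym (ℤP.*-identityʳ q)))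
  ... | no  _     | inj₁ t≡-c  = trans t≡-c (trans (sym (ℤP.+-identityˡ (- c))) (cong (_- c) (sym (ℤP.*-zeroʳ q))))
  ... | no  t≢q-c | inj₂ t≡q-c = ⊥-elim (t≢q-c t≡q-c)

  ≤-[p-t]+[z-s]⇒t+s≤z : ∀ {p t z s} → p ≤ (p - t) + (z - s) → t + s ≤ z
  ≤-[p-t]+[z-s]⇒t+s≤z {p} {t} {z} {s} p≤A = begin
    t + s                                   ≡⟨ regroup p t z s ⟩
    z - (((p - t) + (z - s)) - p)           ≤⟨ ℤP.+-monoʳ-≤ z (ℤP.neg-mono-≤ (ℤP.i≤j⇒0≤j-i p≤A)) ⟩
    z + 0ℤ                                  ≡⟨ ℤP.+-identityʳ z ⟩
    z                                       ∎
    where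
    open ℤP.≤-Reasoning
    regroup : ∀ p t z s → t + s ≡ z - (((p - t) + (z - s)) - p)
    regroup = solve-∀

  module QuadraticCharacterSums (d : ℕ) (prime : Prime (suc (d ℕ.+ d))) (P : Coeffs (suc (d ℕ.+ d)) d) where

    open EulerCriterion d prime

    c : ℕ
    c = toℕ (lead P)

    coefficients : Vec ℤ (suc d)
    coefficients = Vec.tabulate (+_ ∘ toℕ ∘ P)

    private
      monomialSum : ℕ → ℕ
      monomialSum x = sum (map (λ i → toℕ (P i) ℕ.* x ℕ.^ toℕ i) (allFin (suc d)))

    eval<p : ∀ x → eval P x ℕ.< p
    eval<p x = ℕDM.m%n<n (monomialSum x) p

    eval≈⟦⟧ : ∀ x → + eval P x ≈ ⟦ coefficients ⟧ (+ x)
    eval≈⟦⟧ x = ≈-trans (%-≈ (monomialSum x)) (≈-reflexive (sum-monomials≡⟦⟧ (toℕ ∘ P) x))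

    last-coefficients : last coefficients ≡ + c
    last-coefficients = last-tabulate (+_ ∘ toℕ ∘ P)

    zeros : ℤ
    zeros = ∑[ x < p ] 𝟙 (eval P x ℕP.≟ 0)

    zeros≤d : 0 ℕ.< c → zeros ≤ + d
    zeros≤d c>0 = begin
      zeros
        ≡⟨ ∑-cong p (λ x _ → 𝟙-cong (eval P x ℕP.≟ 0) (⟦ coefficients ⟧ (+ x) ≈? 0ℤ) (to x) (from x)) ⟩
      roots coefficients
        ≤⟨ root-bound coefficients (subst (_≉ 0ℤ) (sym last-coefficients) (positive≉0 c>0 (toℕ<n (lead P)))) ⟩
      + d ∎
      where
      open ℤP.≤-Reasoning
      to : ∀ x → eval P x ≡ 0 → ⟦ coefficients ⟧ (+ x) ≈ 0ℤ
      to x Px≡0 = ≈-trans (≈-sym (eval≈⟦⟧ x)) (≈-reflexive (cong +_ Px≡0))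
      from : ∀ x → ⟦ coefficients ⟧ (+ x) ≈ 0ℤ → eval P x ≡ 0
      from x root = residue-injective (eval<p x) (s≤s z≤n) (≈-trans (eval≈⟦⟧ x) root)

    subMod<p : ∀ x γ → subMod p x γ ℕ.< p
    subMod<p x γ = ℕDM.m%n<n (x ℕ.+ (p ℕ.∸ γ % p)) p

    subMod≈ : ∀ x {γ} → γ ℕ.< p → + subMod p x γ ≈ + x - + γ
    subMod≈ x {γ} γ<p = begin
      + subMod p x γ
        ≈⟨ %-≈ (x ℕ.+ (p ℕ.∸ γ % p)) ⟩
      + (x ℕ.+ (p ℕ.∸ γ % p))
        ≡⟨ cong (λ g → + (x ℕ.+ (p ℕ.∸ g))) (ℕDM.m<n⇒m%n≡m γ<p) ⟩
      + (x ℕ.+ (p ℕ.∸ γ))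
        ≡⟨ ℤP.pos-+ x (p ℕ.∸ γ) ⟩
      + x + + (p ℕ.∸ γ)
        ≡⟨ cong (_+_ (+ x)) (trans (sym (ℤP.⊖-≥ (ℕP.<⇒≤ γ<p))) (sym (ℤP.m-n≡m⊖n p γ))) ⟩
      + x + (+ p - + γ)
        ≈⟨ +-cong (≈-refl {+ x}) (-‿cong modulus≈0 (≈-refl {+ γ})) ⟩
      + x + (0ℤ - + γ)
        ≡⟨ cong (_+_ (+ x)) (ℤP.+-identityˡ (- + γ)) ⟩
      + x - + γ ∎
      where open ≈-Reasoning

    subMod-diag : ∀ {γ} → γ ℕ.< p → subMod p γ γ ≡ 0
    subMod-diag {γ} γ<p = begin
      (γ ℕ.+ (p ℕ.∸ γ % p)) % p   ≡⟨ cong (λ g → (γ ℕ.+ (p ℕ.∸ g)) % p) (ℕDM.m<n⇒m%n≡m γ<p) ⟩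
      (γ ℕ.+ (p ℕ.∸ γ)) % p       ≡⟨ cong (_% p) (ℕP.m+[n∸m]≡n (ℕP.<⇒≤ γ<p)) ⟩
      p % p                       ≡⟨ ℕDM.n%n≡0 p ⟩
      0                           ∎
      where open ≡-Reasoning

    χ : ℕ → ℕ → ℤ
    χ γ x = legendre p (subMod p x γ)

    χ≈ : ∀ x {γ} → γ ℕ.< p → χ γ x ≈ (+ x - + γ) ^ d
    χ≈ x {γ} γ<p = ≈-trans (euler-criterion (subMod<p x γ)) (^-cong d (subMod≈ x γ<p))

    χ-diag : ∀ {γ} → γ ℕ.< p → χ γ γ ≡ 0ℤ
    χ-diag γ<p = cong (legendre p) (subMod-diag γ<p)

    χ-bounded : ∀ γ x → -1ℤ ≤ χ γ x × χ γ x ≤ 1ℤ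
    χ-bounded γ x = legendre-bounded p (subMod p x γ)

    private
      d<n : d ℕ.< d ℕ.+ d
      d<n = ℕP.m<m+n d d>0

      ∑-signs≈0⇒≡0 : ∀ (f : ℕ → ℤ) {a} → a ℕ.< p → f a ≡ 0ℤ →
                     (∀ x → x ℕ.< p → -1ℤ ≤ f x × f x ≤ 1ℤ) →
             ∑< p f ≈ 0ℤ → ∑< p f ≡ 0ℤ
      ∑-signs≈0⇒≡0 f a<p fa≡0 signs ∑≈0 = ≈0-bounded⇒≡0 ∑≈0 (proj₁ bounds) (proj₂ bounds)
        where bounds = ∑-signs-with-zero p f a<p fa≡0 signs

    ∑ₓχ≡0 : ∀ {γ} → γ ℕ.< p → ∑[ x < p ] χ γ x ≡ 0ℤ
    ∑ₓχ≡0 {γ} γ<p = ∑-signs≈0⇒≡0 (χ γ) γ<p (χ-diag γ<p) (λ x _ → χ-bounded γ x)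
      (≈-trans (∑-cong-≈ p λ x _ → χ≈ x γ<p) (∑-[x-a]^k≈0 (+ γ) d d<n))

    ∑ᵧχ≡0 : ∀ {x} → x ℕ.< p → ∑[ γ < p ] χ γ x ≡ 0ℤ
    ∑ᵧχ≡0 {x} x<p = ∑-signs≈0⇒≡0 (λ γ → χ γ x) x<p (χ-diag x<p) (λ γ _ → χ-bounded γ x) (begin
      ∑[ γ < p ] χ γ x
        ≈⟨ ∑-cong-≈ p (λ γ γ<p → χ≈ x γ<p) ⟩
      ∑[ γ < p ] (+ x - + γ) ^ d
        ≡⟨ ∑-cong p (λ γ _ → trans (cong (_^ d) (flip (+ x) (+ γ))) (^-distrib-* -1ℤ (+ γ - + x) d)) ⟩
      ∑[ γ < p ] -1ℤ ^ d * (+ γ - + x) ^ d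
        ≡⟨ *-distribˡ-∑ p (-1ℤ ^ d) (λ γ → (+ γ - + x) ^ d) ⟨
      -1ℤ ^ d * (∑[ γ < p ] (+ γ - + x) ^ d)
        ≈⟨ *-cong (≈-refl { -1ℤ ^ d}) (∑-[x-a]^k≈0 (+ x) d d<n) ⟩
      -1ℤ ^ d * 0ℤ
        ≡⟨ ℤP.*-zeroʳ (-1ℤ ^ d) ⟩
      0ℤ ∎)
      where
      open ≈-Reasoning
      flip : ∀ a b → a - b ≡ -1ℤ * (b - a)
      flip = solve-∀

    T : ℕ → ℤ
    T γ = ∑[ x < p ] + eval P x * χ γ x

    T≈-c : ∀ {γ} → γ ℕ.< p → T γ ≈ - + c
    T≈-c {γ} γ<p = begin
      ∑[ x < p ] + eval P x * χ γ x
        ≈⟨ ∑-cong-≈ p (λ x _ → *-cong (eval≈⟦⟧ x) (χ≈ x γ<p)) ⟩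
      ∑[ x < p ] ⟦ coefficients ⟧ (+ x) * (+ x - + γ) ^ d
        ≡⟨ ∑-cong p (λ x _ → trans (ℤP.*-comm (⟦ coefficients ⟧ (+ x)) ((+ x - + γ) ^ d))
                                   (sym (⟦mulLinear^⟧ (+ γ) d coefficients (+ x)))) ⟩
      ∑[ x < p ] ⟦ Q ⟧ (+ x)
        ≈⟨ ∑⟦⟧-top Q ⟩
      - last Q
        ≡⟨ cong -_ (trans (last-mulLinear^ (+ γ) d coefficients) last-coefficients) ⟩
      - + c ∎
      where
      open ≈-Reasoning
      Q = mulLinear^ (+ γ) d coefficients

    ∑T≡0 : ∑[ γ < p ] T γ ≡ 0ℤ
    ∑T≡0 = begin
      ∑[ γ < p ] ∑[ x < p ] + eval P x * χ γ x
        ≡⟨ ∑-comm p p (λ γ x → + eval P x * χ γ x) ⟩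
      ∑[ x < p ] ∑[ γ < p ] + eval P x * χ γ x
        ≡⟨ ∑-cong p (λ x _ → *-distribˡ-∑ p (+ eval P x) (λ γ → χ γ x)) ⟨
      ∑[ x < p ] + eval P x * (∑[ γ < p ] χ γ x)
        ≡⟨ ∑-cong p (λ x x<p → trans (cong (+ eval P x *_) (∑ᵧχ≡0 x<p)) (ℤP.*-zeroʳ (+ eval P x))) ⟩
      ∑[ x < p ] 0ℤ
        ≡⟨ ∑-zero p ⟩
      0ℤ ∎
      where open ≡-Reasoning

    charSum≡ : ∀ γ → charSum P γ ≡ ∑[ x < p ] 𝟙 (eval P x ℕP.≟ 0) * χ γ x
    charSum≡ γ = trans (foldr-map-applyUpTo p (λ x → if does (eval P x ℕP.≟ 0) then χ γ x else 0ℤ) (λ x → x))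
                       (∑-cong p λ x _ → if-does≡𝟙* (eval P x ℕP.≟ 0) (χ γ x))

    ∑[1-χ]≡p : ∀ {γ} → γ ℕ.< p → ∑[ x < p ] (1ℤ - χ γ x) ≡ + p
    ∑[1-χ]≡p {γ} γ<p = begin
      ∑[ x < p ] (1ℤ - χ γ x)
        ≡⟨ ∑-distrib-- p (λ _ → 1ℤ) (χ γ) ⟩
      ∑[ x < p ] 1ℤ - ∑[ x < p ] χ γ x
        ≡⟨ cong₂ _-_ (trans (∑-const p 1ℤ) (ℤP.*-identityʳ (+ p))) (∑ₓχ≡0 γ<p) ⟩
      + p - 0ℤ
        ≡⟨ ℤP.+-identityʳ (+ p) ⟩
      + p ∎
      where open ≡-Reasoning

    module _ (values-sum-to-p : valueSum P ≡ p) where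

      ∑eval≡p : ∑[ x < p ] + eval P x ≡ + p
      ∑eval≡p = trans (sym (sum-map-applyUpTo p (eval P) (λ x → x))) (cong +_ values-sum-to-p)

      T-bounded : ∀ γ → - + p ≤ T γ × T γ ≤ + p
      T-bounded γ = lower , upper
        where
        open ℤP.≤-Reasoning
        lower = begin
          - + p
            ≡⟨ cong -_ ∑eval≡p ⟨
          - (∑[ x < p ] + eval P x)
            ≡⟨ ∑-neg p (λ x → + eval P x) ⟨
          ∑[ x < p ] - + eval P x
            ≤⟨ ∑-mono-≤ p (λ x _ → proj₁ (*-sign-bounds (eval P x) (χ-bounded γ x))) ⟩
          T γ ∎
        upper = begin
          T γ
            ≤⟨ ∑-mono-≤ p (λ x _ → proj₂ (*-sign-bounds (eval P x) (χ-bounded γ x))) ⟩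
          ∑[ x < p ] + eval P x
            ≡⟨ ∑eval≡p ⟩
          + p ∎

      T+S≤zeros : ∀ {γ} → γ ℕ.< p → T γ + charSum P γ ≤ zeros
      T+S≤zeros {γ} γ<p = ≤-[p-t]+[z-s]⇒t+s≤z {+ p} {T γ} {zeros} {charSum P γ} (begin
        + p
          ≡⟨ ∑[1-χ]≡p γ<p ⟨
        ∑[ x < p ] (1ℤ - χ γ x)
          ≤⟨ ∑-mono-≤ p (λ x _ → ℤP.≤-trans (1-X≤[a+𝟙[a≡0]][1-X] (eval P x) (proj₂ (χ-bounded γ x)))
                                            (ℤP.≤-reflexive (expand (a x) (z x) (χ γ x)))) ⟩
        ∑[ x < p ] ((a x - a x * χ γ x) + (z x - z x * χ γ x))
          ≡⟨ decompose ⟩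
        (+ p - T γ) + (zeros - charSum P γ) ∎)
        where
        open ℤP.≤-Reasoning
        a z : ℕ → ℤ
        a x = + eval P x
        z x = 𝟙 (eval P x ℕP.≟ 0)
        expand : ∀ a z X → (a + z) * (1ℤ - X) ≡ (a - a * X) + (z - z * X)
        expand = solve-∀
        decompose : ∑[ x < p ] ((a x - a x * χ γ x) + (z x - z x * χ γ x)) ≡ (+ p - T γ) + (zeros - charSum P γ)
        decompose = begin-equality
          ∑[ x < p ] ((a x - a x * χ γ x) + (z x - z x * χ γ x))
            ≡⟨ ∑-distrib-+ p (λ x → a x - a x * χ γ x) (λ x → z x - z x * χ γ x) ⟩
          ∑[ x < p ] (a x - a x * χ γ x) + ∑[ x < p ] (z x - z x * χ γ x)
            ≡⟨ cong₂ _+_ (∑-distrib-- p a (λ x → a x * χ γ x)) (∑-distrib-- p z (λ x → z x * χ γ x)) ⟩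
          (∑< p a - T γ) + (zeros - ∑[ x < p ] z x * χ γ x)
            ≡⟨ cong₂ (λ s t → (s - T γ) + (zeros - t)) ∑eval≡p (sym (charSum≡ γ)) ⟩
          (+ p - T γ) + (zeros - charSum P γ)
            ∎

      module _ (c>0 : 0 ℕ.< c) where

        T-cases : ∀ {γ} → γ ℕ.< p → T γ ≡ - + c ⊎ T γ ≡ + p - + c
        T-cases {γ} γ<p = Sum.map (λ T+c≡0 → trans (unshift (T γ) (+ c) 0ℤ T+c≡0) (ℤP.+-identityˡ (- + c)))
                                  (unshift (T γ) (+ c) (+ p))
                                  (≈0-below-2m T+c≈0 -p<T+c T+c<2p)
          where
          unshift : ∀ t c r → t + c ≡ r → t ≡ r - c
          unshift t c r refl = isolate t c
            where
            isolate : ∀ t c → t ≡ (t + c) - c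
            isolate = solve-∀
          T+c≈0 : T γ + + c ≈ 0ℤ
          T+c≈0 = ≈-trans (+-cong (T≈-c γ<p) (≈-refl {+ c})) (≈-reflexive (ℤP.+-inverseˡ (+ c)))
          -p<T+c : - + p < T γ + + c
          -p<T+c = subst (_< T γ + + c) (ℤP.+-identityʳ (- + p)) (ℤP.+-mono-≤-< (proj₁ (T-bounded γ)) (+<+ c>0))
          T+c<2p : T γ + + c < + p + + p
          T+c<2p = ℤP.+-mono-≤-< (proj₂ (T-bounded γ)) (+<+ (toℕ<n (lead P)))

        T≡p·𝟙-c : ∀ {γ} → γ ℕ.< p → T γ ≡ + p * 𝟙 (T γ ℤP.≟ + p - + c) - + c
        T≡p·𝟙-c {γ} γ<p = two-valued {T γ} {+ p} {+ c} (T-cases γ<p)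

        count-T≡p-c : ∑[ γ < p ] 𝟙 (T γ ℤP.≟ + p - + c) ≡ + c
        count-T≡p-c = ℤP.*-cancelˡ-≡ (+ p) _ _ (ℤP.i-j≡0⇒i≡j _ _ (begin
          + p * (∑[ γ < p ] e γ) - + p * + c
            ≡⟨ cong₂ _-_ (*-distribˡ-∑ p (+ p) e) (sym (∑-const p (+ c))) ⟩
          ∑[ γ < p ] + p * e γ - ∑[ γ < p ] + c
            ≡⟨ ∑-distrib-- p (λ γ → + p * e γ) (λ _ → + c) ⟨
          ∑[ γ < p ] (+ p * e γ - + c)
            ≡⟨ ∑-cong p (λ γ γ<p → T≡p·𝟙-c γ<p) ⟨
          ∑[ γ < p ] T γ
            ≡⟨ ∑T≡0 ⟩
          0ℤ ∎))
          where
          open ≡-Reasoning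
          e : ℕ → ℤ
          e γ = 𝟙 (T γ ℤP.≟ + p - + c)

        ∣charSum∣-large : ∀ {γ} → γ ℕ.< p → T γ ≡ + p - + c → suc d ℕ.≤ c ℕ.+ ∣ charSum P γ ∣
        ∣charSum∣-large {γ} γ<p T≡p-c = ℤP.drop‿+≤+ (begin
          + suc d
            ≡⟨ regroup (+ d) (+ c) S ⟩
          ((+ p - + c) + S) - + d + (+ c - S)
            ≡⟨ cong (λ t → t + S - + d + (+ c - S)) T≡p-c ⟨
          (T γ + S) - + d + (+ c - S)
            ≤⟨ ℤP.+-monoˡ-≤ (+ c - S) (ℤP.+-monoˡ-≤ (- + d) (ℤP.≤-trans (T+S≤zeros γ<p) (zeros≤d c>0))) ⟩
          (+ d - + d) + (+ c - S)
            ≡⟨ trans (cong (_+ (+ c - S)) (ℤP.+-inverseʳ (+ d))) (ℤP.+-identityˡ (+ c - S)) ⟩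
          + c - S
            ≤⟨ ℤP.+-monoʳ-≤ (+ c) (subst (- S ≤_) (cong +_ (ℤP.∣-i∣≡∣i∣ S)) (i≤+∣i∣ (- S))) ⟩
          + c + + ∣ S ∣
            ≡⟨ ℤP.pos-+ c ∣ S ∣ ⟨
          + (c ℕ.+ ∣ S ∣) ∎)
          where
          open ℤP.≤-Reasoning
          S = charSum P γ
          regroup : ∀ d c s → 1ℤ + d ≡ (((1ℤ + (d + d)) - c) + s) - d + (c - s)
          regroup = solve-∀

        module _ (threshold : p ℕ.+ 7 ℕ.* c ℕ.≤ 7 ℕ.* suc d) where

          T≡p-c⇒large : ∀ {γ} → γ ℕ.< p → T γ ≡ + p - + c → p ℕ.≤ 7 ℕ.* ∣ charSum P γ ∣
          T≡p-c⇒large {γ} γ<p T≡p-c = ℕP.+-cancelʳ-≤ (7 ℕ.* c) p (7 ℕ.* s) (begin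
            p ℕ.+ 7 ℕ.* c          ≤⟨ threshold ⟩
            7 ℕ.* suc d            ≤⟨ ℕP.*-monoʳ-≤ 7 (∣charSum∣-large γ<p T≡p-c) ⟩
            7 ℕ.* (c ℕ.+ s)        ≡⟨ spread c s ⟩
            7 ℕ.* s ℕ.+ 7 ℕ.* c    ∎)
            where
            open ℕP.≤-Reasoning
            s = ∣ charSum P γ ∣
            spread : ∀ c s → 7 ℕ.* (c ℕ.+ s) ≡ 7 ℕ.* s ℕ.+ 7 ℕ.* c
            spread = ℕS.solve-∀

          lead≤bigCount : c ℕ.≤ bigCount P
          lead≤bigCount = ℤP.drop‿+≤+ (begin
            + c
              ≡⟨ count-T≡p-c ⟨
            ∑[ γ < p ] 𝟙 (T γ ℤP.≟ + p - + c)
              ≤⟨ ∑-mono-≤ p (λ γ γ<p → 𝟙-mono (T γ ℤP.≟ + p - + c) (large? γ) (T≡p-c⇒large γ<p)) ⟩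
            ∑[ γ < p ] 𝟙 (large? γ)
              ≡⟨ ∑-cong p (λ γ _ → +-if-does≡𝟙 (large? γ)) ⟨
            ∑[ γ < p ] + (if does (large? γ) then 1 else 0)
              ≡⟨ sum-map-applyUpTo p (λ γ → if does (large? γ) then 1 else 0) (λ γ → γ) ⟨
            + bigCount P ∎)
            where
            open ℤP.≤-Reasoning
            large? : ∀ γ → Dec (p ℕ.≤ 7 ℕ.* ∣ charSum P γ ∣)
            large? γ = p ℕP.≤? 7 ℕ.* ∣ charSum P γ ∣

open import Data.Nat using (ℕ; _+_; _*_; _∸_; _≤_; _<_; NonZero)
open import Data.Nat.DivMod using (_%_)
open import Data.Nat.Primality using (Prime)
open import Data.Fin using (toℕ)
open import Relation.Binary.PropositionalEquality using (_≡_; _≢_)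
open import Data.Nat using (suc; z≤n; s≤s; _/_)
import Data.Nat.Properties as ℕP
import Data.Nat.DivMod as ℕDM
open import Data.Nat.Tactic.RingSolver using (solve-∀)
open import Relation.Binary.PropositionalEquality using (refl; sym; trans; cong; subst)

odd⇒≡1+2·half : ∀ {p} → p % 2 ≡ 1 → p ≡ suc (half p + half p)
odd⇒≡1+2·half {p} odd = trans p≡1+2q (cong suc (trans (double q) (cong (λ h → h + h) (sym half≡q))))
  where
  q = p / 2
  p≡1+2q : p ≡ suc (q * 2)
  p≡1+2q = trans (ℕDM.m≡m%n+[m/n]*n p 2) (cong (_+ q * 2) odd)
  half≡q : half p ≡ q
  half≡q = trans (cong (_/ 2) (cong (_∸ 1) p≡1+2q)) (ℕDM.m*n/n≡m q 2)
  double : ∀ q → q * 2 ≡ q + q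
  double = solve-∀

module _ (d c : ℕ) (bound : 14 * c + 2 * suc (d + d) ≤ 7 * (d + d)) where

  bound⇒c≤d : c ≤ d
  bound⇒c≤d = ℕP.*-cancelˡ-≤ 14 (begin
    14 * c                      ≤⟨ ℕP.m≤m+n (14 * c) (2 * suc (d + d)) ⟩
    14 * c + 2 * suc (d + d)    ≤⟨ bound ⟩
    7 * (d + d)                 ≡⟨ regroup d ⟩
    14 * d                      ∎)
    where
    open ℕP.≤-Reasoning
    regroup : ∀ d → 7 * (d + d) ≡ 14 * d
    regroup = solve-∀

  bound⇒threshold : suc (d + d) + 7 * c ≤ 7 * suc d
  bound⇒threshold = ℕP.*-cancelˡ-≤ 2 (begin
    2 * (suc (d + d) + 7 * c)   ≡⟨ expand d c ⟩
    14 * c + 2 * suc (d + d)    ≤⟨ bound ⟩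
    7 * (d + d)                 ≤⟨ ℕP.*-monoʳ-≤ 7 (ℕP.+-mono-≤ (ℕP.n≤1+n d) (ℕP.n≤1+n d)) ⟩
    7 * (suc d + suc d)         ≡⟨ regroup (suc d) ⟩
    2 * (7 * suc d)             ∎)
    where
    open ℕP.≤-Reasoning
    expand : ∀ d c → 2 * (suc (d + d) + 7 * c) ≡ 14 * c + 2 * suc (d + d)
    expand = solve-∀
    regroup : ∀ e → 7 * (e + e) ≡ 2 * (7 * e)
    regroup = solve-∀

leading-coefficient≤bigCount : ∀ p .{{_ : NonZero p}} → Prime p → p % 2 ≡ 1 → (P : Coeffs p (half p)) → valueSum P ≡ p →
                               ∀ c → 0 < c → 14 * c + 2 * p ≤ 7 * (p ∸ 1) → toℕ (lead P) ≡ c % p → c ≤ bigCount P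
leading-coefficient≤bigCount p p-prime odd = at-odd p (half p) (odd⇒≡1+2·half odd) p-prime
  where
  at-odd : ∀ p d .{{_ : NonZero p}} → p ≡ suc (d + d) → Prime p → (P : Coeffs p d) → valueSum P ≡ p →
           ∀ c → 0 < c → 14 * c + 2 * p ≤ 7 * (p ∸ 1) → toℕ (lead P) ≡ c % p → c ≤ bigCount P
  at-odd _ d refl p-prime P values-sum c c>0 bound lead≡c%p =
    subst (_≤ bigCount P) lead≡c
      (QuadraticCharacterSums.lead≤bigCount d p-prime P values-sum (subst (0 <_) (sym lead≡c) c>0)
        (subst (λ c → suc (d + d) + 7 * c ≤ 7 * suc d) (sym lead≡c) (bound⇒threshold d c bound)))
    where
    lead≡c : toℕ (lead P) ≡ c
    lead≡c = trans lead≡c%p (ℕDM.m<n⇒m%n≡m (s≤s (ℕP.≤-trans (bound⇒c≤d d c bound) (ℕP.m≤m+n d d))))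

lemma3p7 : (p : ℕ) .{{_ : NonZero p}} → Prime p → p % 2 ≡ 1 →
    (P : Coeffs p (half p)) → toℕ (lead P) ≢ 0 →
    valueSum P ≡ p →
    (k : ℕ) → bigCount P ≤ k →
    (c : ℕ) → k < c → 14 * c + 2 * p ≤ 7 * (p ∸ 1) →
    toℕ (lead P) ≢ c % p
lemma3p7 p p-prime odd P _ values-sum k count≤k c k<c bound lead≡c%p = ℕP.<⇒≱ k<c (begin
  c            ≤⟨ leading-coefficient≤bigCount p p-prime odd P values-sum c (ℕP.≤-<-trans z≤n k<c) bound lead≡c%p ⟩
  bigCount P   ≤⟨ count≤k ⟩
  k            ∎)
  where open ℕP.≤-Reasoning
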